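{- Let $\Sigma\subseteq\mathcal L_\lozenge$ be finite and closed under subformulas, let $\mathcal I=\mathcal I_\Sigma$, let $w\in|\mathcal I|$ and let $\psi\in\Sigma$. Then, writing $\vdash$ for derivability in ${\sf ITL}^0_\lozenge$: (1) if $\psi\in\ell^-_\mathcal I(w)$, then $\vdash\psi\to\mathrm{Sim}(w)$; (2) if $\psi\in\ell^+_\mathcal I(w)$, then $\vdash(\psi\to\mathrm{Sim}(w))\to\mathrm{Sim}(w)$; (3) if $w\preccurlyeq_\mathcal I v$, then $\vdash\mathrm{Sim}(v)\to\mathrm{Sim}(w)$; (4) $\vdash\bigwedge\{\mathrm{Sim}(u): u\in|\mathcal I|,\ \psi\in\ell^-_\mathcal I(u)\}\to\psi$; (5) $\vdash\bigcirc\bigwedge\{\mathrm{Sim}(v): w\,S_\mathcal I\,v\}\to\mathrm{Sim}(w)$.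
   Context: $\mathcal L_\lozenge$ is the language $\bot\mid p\mid\varphi\wedge\psi\mid\varphi\vee\psi\mid\varphi\to\psi\mid\bigcirc\varphi\mid\lozenge\varphi$. ${\sf ITL}^0_\lozenge$ is the least set of $\mathcal L_\lozenge$-formulas containing all intuitionistic propositional tautologies and all instances of $\neg\bigcirc\bot$; $\bigcirc\varphi\wedge\bigcirc\psi\to\bigcirc(\varphi\wedge\psi)$; $\bigcirc(\varphi\vee\psi)\to\bigcirc\varphi\vee\bigcirc\psi$; $\bigcirc(\varphi\to\psi)\to(\bigcirc\varphi\to\bigcirc\psi)$; $\varphi\vee\bigcirc\lozenge\varphi\to\lozenge\varphi$; closed under modus ponens, from $\varphi$ infer $\bigcirc\varphi$, from $\varphi\to\psi$ infer $\lozenge\varphi\to\lozenge\psi$, from $\bigcirc\varphi\to\varphi$ infer $\lozenge\varphi\to\varphi$. Types: a $\Sigma$-type is a pair $(\Phi^-;\Phi^+)$ of subsets of $\Sigma$ with $\Phi^-\cap\Phi^+=\varnothing$, $\Phi^-\cup\Phi^+=\Sigma$, $\bot\notin\Phi^+$; $\varphi\wedge\psi\in\Phi^+$ iff $\varphi,\psi\in\Phi^+$; $\varphi\vee\psi\in\Phi^+$ iff $\varphi\in\Phi^+$ or $\psi\in\Phi^+$; $\varphi\to\psi\in\Phi^+$ implies $\varphi\in\Phi^-$ or $\psi\in\Phi^+$; $\lozenge\varphi\in\Phi^-$ implies $\varphi\in\Phi^-$. $\Phi\,S_T\,\Psi$ iff for all $\varphi$: $\bigcirc\varphi\in\Phi^\pm\Rightarrow\varphi\in\Psi^\pm$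 (both signs); ($\lozenge\varphi\in\Phi^+$ and $\varphi\in\Phi^-$) $\Rightarrow\lozenge\varphi\in\Psi^+$; $\lozenge\varphi\in\Phi^-\Rightarrow\lozenge\varphi\in\Psi^-$. A $\Sigma$-labelled frame is $(W,\preccurlyeq,\ell)$, $\preccurlyeq$ a partial order, $\ell$ into $\Sigma$-types, $w\preccurlyeq v\Rightarrow\ell^+(w)\subseteq\ell^+(v)$, and if $\varphi\to\psi\in\ell^-(w)$ then some $v\succcurlyeq w$ has $\varphi\in\ell^+(v),\psi\in\ell^-(v)$. A relation $R$ between labelled frames is forward-confluent if $x\,R\,y$ and $x\preccurlyeq x'$ imply $x'\,R\,y'$ for some $y'\succcurlyeq y$; it is sensible if $x\,R\,y$ implies $\ell(x)\,S_T\,\ell(y)$. The structure $\mathcal I_\Sigma$: a $\Sigma$-moment is a $\Sigma$-labelled frame $\mathbf w$ whose order is a finite tree with root $r_\mathbf w$. For moments, $\mathbf w\sqsubseteq\mathbf v$ means $|\mathbf w|\subseteq|\mathbf v|$ with order and labelling restricted from $\mathbf v$; $\mathbf w\unlhd\mathbf v$ means $\mathbf w\sqsubseteq\mathbf v$ and there is a surjective order-preserving $\pi:|\mathbf v|\to|\mathbf w|$ with $\pi\circ\pi=\pi$ and $\ell_\mathbf v(x)=\ell_\mathbf w(\pi(x))$ for all $x$. A moment $\mathbf w$ is irreducible if $\mathbf v\unlhd\mathbf w$ implies $\mathbf v=\mathbf w$; $I_\Sigma$ is the (finite) set of irreducible $\Sigma$-moments up to isomorphism. For $x\in|\mathbf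 w|$, $\mathbf w[x]$ is the restriction of $\mathbf w$ to $\{y:y\succcurlyeq x\}$. Then $\mathcal I_\Sigma=(I_\Sigma,\preccurlyeq_\mathcal I,S_\mathcal I,\ell_\mathcal I)$ with $\mathbf v\preccurlyeq_\mathcal I\mathbf w$ iff $\mathbf w=\mathbf v[x]$ for some $x\in|\mathbf v|$; $\mathbf w\,S_\mathcal I\,\mathbf v$ iff some sensible forward-confluent relation $S\subseteq|\mathbf w|\times|\mathbf v|$ has $r_\mathbf w\,S\,r_\mathbf v$; and $\ell_\mathcal I(\mathbf w)=\ell_\mathbf w(r_\mathbf w)$. Simulation formulas: for $w\in I_\Sigma$, defined by backward induction on $\preccurlyeq_\mathcal I$, $\mathrm{Sim}(w)=\bigwedge\ell_\mathcal I^+(w)\to\big(\bigvee\ell_\mathcal I^-(w)\vee\bigvee_{v\succ_\mathcal I w}\mathrm{Sim}(v)\big)$ (empty conjunction $\top$, empty disjunction $\bot$). -}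

module Defs where

open import Data.Nat using (ℕ)
open import Data.Bool using (Bool; true; false)
open import Data.Fin using (Fin)
open import Data.List using (List; []; _∷_; _++_; length; lookup)
open import Data.List.Membership.Propositional using (_∈_)
open import Data.Product using (_×_; ∃; _,_)
open import Data.Sum using (_⊎_)
open import Relation.Binary.PropositionalEquality using (_≡_)

infixr 5 _⇒_
infixr 6 _∨_
infixr 7 _∧_
infix 9 ○_ ◇_

data Fm : Set where
  ⊥ᶠ  : Fm
  var : ℕ → Fm
  _∧_ : Fm → Fm → Fm
  _∨_ : Fm → Fm → Fm
  _⇒_ : Fm → Fm → Fm
  ○_  : Fm → Fm
  ◇_  : Fm → Fm

infix 9 ¬ᶠ_
¬ᶠ_ : Fm → Fm
¬ᶠ φ = φ ⇒ ⊥ᶠ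

⊤ᶠ : Fm
⊤ᶠ = ⊥ᶠ ⇒ ⊥ᶠ

⋀ : List Fm → Fm
⋀ []       = ⊤ᶠ
⋀ (φ ∷ φs) = φ ∧ ⋀ φs

⋁ : List Fm → Fm
⋁ []       = ⊥ᶠ
⋁ (φ ∷ φs) = φ ∨ ⋁ φs

-- Intuitionistic propositional tautologies
-- (all L◇-substitution instances) are generated by a standard complete
-- Hilbert axiomatisation of IPC together with modus ponens.

infix 3 ⊢_

data ⊢_ : Fm → Set where
  ax-K   : ∀ {φ ψ} → ⊢ φ ⇒ ψ ⇒ φ
  ax-S   : ∀ {φ ψ χ} → ⊢ (φ ⇒ ψ ⇒ χ) ⇒ (φ ⇒ ψ) ⇒ φ ⇒ χ
  ax-∧I  : ∀ {φ ψ} → ⊢ φ ⇒ ψ ⇒ φ ∧ ψ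
  ax-∧E₁ : ∀ {φ ψ} → ⊢ φ ∧ ψ ⇒ φ
  ax-∧E₂ : ∀ {φ ψ} → ⊢ φ ∧ ψ ⇒ ψ
  ax-∨I₁ : ∀ {φ ψ} → ⊢ φ ⇒ φ ∨ ψ
  ax-∨I₂ : ∀ {φ ψ} → ⊢ ψ ⇒ φ ∨ ψ
  ax-∨E  : ∀ {φ ψ χ} → ⊢ (φ ⇒ χ) ⇒ (ψ ⇒ χ) ⇒ φ ∨ ψ ⇒ χ
  ax-⊥E  : ∀ {φ} → ⊢ ⊥ᶠ ⇒ φ
  ax-¬○⊥ : ⊢ ¬ᶠ ○ ⊥ᶠ
  ax-○∧  : ∀ {φ ψ} → ⊢ ○ φ ∧ ○ ψ ⇒ ○ (φ ∧ ψ)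
  ax-○∨  : ∀ {φ ψ} → ⊢ ○ (φ ∨ ψ) ⇒ ○ φ ∨ ○ ψ
  ax-○⇒  : ∀ {φ ψ} → ⊢ ○ (φ ⇒ ψ) ⇒ ○ φ ⇒ ○ ψ
  ax-◇   : ∀ {φ} → ⊢ φ ∨ ○ ◇ φ ⇒ ◇ φ
  mp     : ∀ {φ ψ} → ⊢ φ ⇒ ψ → ⊢ φ → ⊢ ψ
  nec    : ∀ {φ} → ⊢ φ → ⊢ ○ φ
  ◇-mono : ∀ {φ ψ} → ⊢ φ ⇒ ψ → ⊢ ◇ φ ⇒ ◇ ψ
  ◇-ind  : ∀ {φ} → ⊢ ○ φ ⇒ φ → ⊢ ◇ φ ⇒ φ

data ImmSub : Fm → Fm → Set where
  ∧ˡ : ∀ {φ ψ} → ImmSub φ (φ ∧ ψ)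
  ∧ʳ : ∀ {φ ψ} → ImmSub ψ (φ ∧ ψ)
  ∨ˡ : ∀ {φ ψ} → ImmSub φ (φ ∨ ψ)
  ∨ʳ : ∀ {φ ψ} → ImmSub ψ (φ ∨ ψ)
  ⇒ˡ : ∀ {φ ψ} → ImmSub φ (φ ⇒ ψ)
  ⇒ʳ : ∀ {φ ψ} → ImmSub ψ (φ ⇒ ψ)
  ○ˢ : ∀ {φ} → ImmSub φ (○ φ)
  ◇ˢ : ∀ {φ} → ImmSub φ (◇ φ)

SubClosed : List Fm → Set
SubClosed Σ₀ = ∀ {φ ψ} → ImmSub φ ψ → ψ ∈ Σ₀ → φ ∈ Σ₀

-- Labels: a label ℓ : Fm → Bool represents the pair
-- (Φ⁻ ; Φ⁺) = ({φ ∈ Σ | ℓ φ = false} ; {φ ∈ Σ | ℓ φ = true});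
-- values outside Σ are irrelevant (labels are compared only on Σ).
-- This automatically gives Φ⁻ ∩ Φ⁺ = ∅ and Φ⁻ ∪ Φ⁺ = Σ.

Label : Set
Label = Fm → Bool

plus : Label → List Fm → List Fm
plus ℓ [] = []
plus ℓ (φ ∷ φs) with ℓ φ
... | true  = φ ∷ plus ℓ φs
... | false = plus ℓ φs

minus : Label → List Fm → List Fm
minus ℓ [] = []
minus ℓ (φ ∷ φs) with ℓ φ
... | true  = minus ℓ φs
... | false = φ ∷ minus ℓ φs

-- Finite rooted trees labelled by labels (the underlying data of moments);
-- nodes are positions, the order is the tree (prefix) order.

data Tree : Set where
  node : Label → List Tree → Tree

data Pos : Tree → Set where
  here  : ∀ {ℓ cs} → Pos (node ℓ cs)
  child : ∀ {ℓ cs} (i : Fin (length cs)) → Pos (lookup cs i) → Pos (node ℓ cs)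

top : (t : Tree) → Pos t
top (node ℓ cs) = here

infix 4 _≼_
data _≼_ : {t : Tree} → Pos t → Pos t → Set where
  here≼  : ∀ {ℓ cs} {p : Pos (node ℓ cs)} → here ≼ p
  child≼ : ∀ {ℓ cs} {i : Fin (length cs)} {p q : Pos (lookup cs i)} →
           p ≼ q → child {ℓ} {cs} i p ≼ child i q

lab : (t : Tree) → Pos t → Label
lab (node ℓ cs) here        = ℓ
lab (node ℓ cs) (child i p) = lab (lookup cs i) p

-- t[x] : restriction of t to the up-set of x
sub : (t : Tree) → Pos t → Tree
sub (node ℓ cs) here        = node ℓ cs
sub (node ℓ cs) (child i p) = sub (lookup cs i) p

module _ (Σ₀ : List Fm) where

  _≈L_ : Label → Label → Set
  ℓ ≈L ℓ' = ∀ φ → φ ∈ Σ₀ → ℓ φ ≡ ℓ' φ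

  record IsType (ℓ : Label) : Set where
    field
      bot  : ⊥ᶠ ∈ Σ₀ → ℓ ⊥ᶠ ≡ false
      and⁺ : ∀ {φ ψ} → (φ ∧ ψ) ∈ Σ₀ → ℓ (φ ∧ ψ) ≡ true → ℓ φ ≡ true × ℓ ψ ≡ true
      and⁻ : ∀ {φ ψ} → (φ ∧ ψ) ∈ Σ₀ → ℓ φ ≡ true → ℓ ψ ≡ true → ℓ (φ ∧ ψ) ≡ true
      or⁺  : ∀ {φ ψ} → (φ ∨ ψ) ∈ Σ₀ → ℓ (φ ∨ ψ) ≡ true → ℓ φ ≡ true ⊎ ℓ ψ ≡ true
      or⁻  : ∀ {φ ψ} → (φ ∨ ψ) ∈ Σ₀ → ℓ φ ≡ true ⊎ ℓ ψ ≡ true → ℓ (φ ∨ ψ) ≡ true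
      imp  : ∀ {φ ψ} → (φ ⇒ ψ) ∈ Σ₀ → ℓ (φ ⇒ ψ) ≡ true → ℓ φ ≡ false ⊎ ℓ ψ ≡ true
      dia  : ∀ {φ} → (◇ φ) ∈ Σ₀ → ℓ (◇ φ) ≡ false → ℓ φ ≡ false

  record ST (ℓ ℓ' : Label) : Set where
    field
      next : ∀ {φ} → (○ φ) ∈ Σ₀ → ℓ (○ φ) ≡ ℓ' φ
      dia⁺ : ∀ {φ} → (◇ φ) ∈ Σ₀ → ℓ (◇ φ) ≡ true → ℓ φ ≡ false → ℓ' (◇ φ) ≡ true
      dia⁻ : ∀ {φ} → (◇ φ) ∈ Σ₀ → ℓ (◇ φ) ≡ false → ℓ' (◇ φ) ≡ false

  record IsMoment (t : Tree) : Set where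
    field
      typed   : ∀ p → IsType (lab t p)
      mono    : ∀ {p q} → p ≼ q → ∀ φ → φ ∈ Σ₀ → lab t p φ ≡ true → lab t q φ ≡ true
      witness : ∀ p {φ ψ} → (φ ⇒ ψ) ∈ Σ₀ → lab t p (φ ⇒ ψ) ≡ false →
                ∃ λ q → p ≼ q × lab t q φ ≡ true × lab t q ψ ≡ false

  -- v ⊴ w : v is (an isomorphic copy of) a sub-moment of w, via the
  -- order embedding ι, and π is an order-preserving retraction of w
  -- onto (the image of) v preserving labels.
  record _⊴_ (v w : Tree) : Set where
    field
      ι     : Pos v → Pos w
      π     : Pos w → Pos v
      ι-mono : ∀ {p q} → p ≼ q → ι p ≼ ι q
      ι-refl : ∀ {p q} → ι p ≼ ι q → p ≼ q
      ι-lab  : ∀ p → lab v p ≈L lab w (ι p)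
      π-mono : ∀ {x y} → x ≼ y → π x ≼ π y
      π-ι    : ∀ p → π (ι p) ≡ p
      π-lab  : ∀ x → lab w x ≈L lab v (π x)

  open _⊴_ public

  Irreducible : Tree → Set
  Irreducible w = (v : Tree) → IsMoment v → (r : v ⊴ w) → ∀ x → ∃ λ p → ι r p ≡ x

  InI : Tree → Set
  InI w = IsMoment w × Irreducible w

  -- isomorphism of labelled trees (I_Σ is taken up to isomorphism)
  record Iso (t u : Tree) : Set where
    field
      f     : Pos t → Pos u
      g     : Pos u → Pos t
      gf    : ∀ p → g (f p) ≡ p
      fg    : ∀ q → f (g q) ≡ q
      f-mono : ∀ {p q} → p ≼ q → f p ≼ f q
      g-mono : ∀ {p q} → p ≼ q → g p ≼ g q
      f-lab  : ∀ p → lab t p ≈L lab u (f p)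

  _≼I_ : Tree → Tree → Set
  w ≼I v = ∃ λ (x : Pos w) → Iso v (sub w x)

  record SI (w v : Tree) : Set₁ where
    field
      R         : Pos w → Pos v → Set
      roots     : R (top w) (top v)
      sensible  : ∀ {x y} → R x y → ST (lab w x) (lab v y)
      confluent : ∀ {x y x'} → R x y → x ≼ x' → ∃ λ y' → y ≼ y' × R x' y'

  -- Simulation formulas.  The strict ≼_I-successors of w are (up to
  -- isomorphism) the subtrees w[x], x ≠ root; descSims lists Sim of all
  -- proper subtrees.
  mutual
    Sim : Tree → Fm
    Sim (node ℓ cs) = ⋀ (plus ℓ Σ₀) ⇒ (⋁ (minus ℓ Σ₀) ∨ ⋁ (descSims cs))

    descSims : List Tree → List Fm
    descSims []       = []
    descSims (c ∷ cs) = Sim c ∷ (descOf c ++ descSims cs)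

    descOf : Tree → List Fm
    descOf (node ℓ ds) = descSims ds

module Submission where

-- Parts (1) and (2) are read off the shape of Sim(w).  For the rest, Sim(t) is a characteristic
-- formula: in a moment m it fails at y exactly when t maps into m above y, monotonically and
-- preserving labels on Σ.  The calculus is complete for finite moments: a terminating proof search
-- yields either a derivation of α ⇒ β or a finite moment, over a subformula-closed Σ⁺ ⊇ Σ ∪ {α, β},
-- whose root makes α true and β false.  Each of (3)–(5) is proved by refuting every such countermodel.
-- For (3), the map of w into the countermodel restricts to the subtree v.  For (4), the countermodel
-- has an irreducible reduct with ψ false at its root, i.e. a copy of some u ∈ L, so Sim(u) fails at the
-- root.  For (5), ○ Next(w) ⇒ Sim(w) is derivable, where Next(w) is the characteristic formula for the
-- requirements that the nodes of w place on their S_T-successors; a countermodel refuting Next(w) above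
-- a point y₀ gives an irreducible reduct v of the moment above y₀ with w S_I v, and v is a copy of
-- some v' ∈ L.

open import Defs
open import Data.Bool using (Bool; true; false; if_then_else_)
open import Data.Bool.Properties using (¬-not)
open import Data.Empty using (⊥-elim)
open import Data.Fin as Fin using (Fin; zero; suc)
open import Data.Fin.Properties using (injective⇒≤)
open import Data.List using (List; map; []; _∷_; _++_; length; lookup; concatMap)
open import Data.List.Membership.Propositional using (_∈_; find; lose)
open import Data.List.Membership.Propositional.Properties
  using (∈-++⁺ˡ; ∈-++⁺ʳ; ∈-++⁻; ∈-map⁺; ∈-map⁻; ∈-lookup; ∈-concatMap⁺; ∈-concatMap⁻)
open import Data.List.Properties using (length-map)
open import Data.List.Relation.Unary.All as All using ()
open import Data.List.Relation.Unary.AllPairs using ([]; _∷_)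
open import Data.List.Relation.Unary.Any as Any using (here; there)
open import Data.List.Relation.Unary.Any.Properties using (lookup-index)
open import Data.List.Relation.Unary.Unique.Propositional using (Unique)
import Data.List.Relation.Unary.Unique.Propositional.Properties as Unique
open import Data.Nat as ℕ using (ℕ; suc; z≤n; s≤s)
open import Data.Nat.Properties using (m≤n⇒m≤1+n; ≤-refl; ≤-trans; <-≤-trans)
open import Data.Product using (_×_; ∃; _,_; proj₁; proj₂; map₁)
open import Data.Sum as Sum using (_⊎_; inj₁; inj₂; [_,_])
open import Data.Unit using (⊤; tt)
open import Function using (_∘_; flip; id)
open import Relation.Binary.Definitions using (DecidableEquality)
open import Relation.Binary.PropositionalEquality
  using (_≡_; _≢_; refl; sym; trans; cong; cong₂; subst; subst₂; module ≡-Reasoning)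
open import Relation.Nullary using (¬_)
open import Relation.Nullary.Decidable using (yes; no; does; map′; _×-dec_; dec-true; dec-false)

⇒-refl : ∀ {φ} → ⊢ φ ⇒ φ
⇒-refl {φ} = mp (mp ax-S ax-K) (ax-K {φ} {φ})

-- Derivations from a single hypothesis G.  Hypotheses are accumulated as
-- left-nested conjunctions and addressed de Bruijn style by hyp and weaken.
infix 2 _▷_
_▷_ : Fm → Fm → Set
G ▷ φ = ⊢ G ⇒ φ

const : ∀ {G φ} → ⊢ φ → G ▷ φ
const d = mp ax-K d

infixl 5 _·_
_·_ : ∀ {G φ ψ} → G ▷ φ ⇒ ψ → G ▷ φ → G ▷ ψ
f · a = mp (mp ax-S f) a

by : ∀ {G φ ψ} → ⊢ φ ⇒ ψ → G ▷ φ → G ▷ ψ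
by f a = const f · a

precompose : ∀ {G G' φ} → ⊢ G' ⇒ G → G ▷ φ → G' ▷ φ
precompose a d = by d a

abs : ∀ {G φ ψ} → G ∧ φ ▷ ψ → G ▷ φ ⇒ ψ
abs d = const (mp ax-S (mp ax-K d)) · ax-∧I

hyp : ∀ {G φ} → G ∧ φ ▷ φ
hyp = ax-∧E₂

weaken : ∀ {G φ ψ} → G ▷ ψ → G ∧ φ ▷ ψ
weaken d = by d ax-∧E₁

pair : ∀ {G φ ψ} → G ▷ φ → G ▷ ψ → G ▷ φ ∧ ψ
pair a b = const ax-∧I · a · b

inl : ∀ {G φ ψ} → G ▷ φ → G ▷ φ ∨ ψ
inl = by ax-∨I₁

inr : ∀ {G φ ψ} → G ▷ ψ → G ▷ φ ∨ ψ
inr = by ax-∨I₂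

case : ∀ {G φ ψ χ} → G ▷ φ ∨ ψ → G ∧ φ ▷ χ → G ∧ ψ ▷ χ → G ▷ χ
case d l r = const ax-∨E · abs l · abs r · d

exfalso : ∀ {G φ} → G ▷ ⊥ᶠ → G ▷ φ
exfalso = by ax-⊥E

⋀-elim : ∀ {φ φs} → φ ∈ φs → ⊢ ⋀ φs ⇒ φ
⋀-elim (here refl) = ax-∧E₁
⋀-elim (there φ∈) = precompose ax-∧E₂ (⋀-elim φ∈)

⋁-intro : ∀ {φ φs} → φ ∈ φs → ⊢ φ ⇒ ⋁ φs
⋁-intro (here refl) = ax-∨I₁
⋁-intro (there φ∈) = inr (⋁-intro φ∈)

○-mono : ∀ {φ ψ} → ⊢ φ ⇒ ψ → ⊢ ○ φ ⇒ ○ ψ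
○-mono d = mp ax-○⇒ (nec d)

○⋁-mono : ∀ φs ψs → (∀ {φ} → φ ∈ φs → ∃ λ ψ → ψ ∈ ψs × ⊢ ○ φ ⇒ ψ) → ⊢ ○ ⋁ φs ⇒ ⋁ ψs
○⋁-mono [] ψs f = exfalso (by ax-¬○⊥ ⇒-refl)
○⋁-mono (φ ∷ φs) ψs f with f (here refl)
... | ψ , ψ∈ , d = case (by ax-○∨ ⇒-refl) (by (⋁-intro ψ∈) (by d hyp)) (by (○⋁-mono φs ψs (f ∘ there)) hyp)

○⋀-collect : ∀ {G D} φs → (∀ {φ} → φ ∈ φs → G ▷ D ∨ ○ φ) → G ▷ D ∨ ○ ⋀ φs
○⋀-collect [] f = inr (const (nec ⇒-refl))
○⋀-collect (φ ∷ φs) f =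
  case (f (here refl)) (inl hyp)
    (case (weaken (○⋀-collect φs (f ∘ there))) (inl hyp) (inr (by ax-○∧ (pair (weaken hyp) hyp))))

⇒◇ : ∀ {φ} → ⊢ φ ⇒ ◇ φ
⇒◇ = by ax-◇ (inl ⇒-refl)

○◇⇒◇ : ∀ {φ} → ⊢ ○ ◇ φ ⇒ ◇ φ
○◇⇒◇ = by ax-◇ (inr ⇒-refl)

◇-unfold : ∀ {φ} → ⊢ ◇ φ ⇒ φ ∨ ○ ◇ φ
◇-unfold {φ} = by (◇-ind ○-closed) (◇-mono (inl ⇒-refl))
  where
  ○-closed : ⊢ ○ (φ ∨ ○ ◇ φ) ⇒ φ ∨ ○ ◇ φ
  ○-closed = case (by ax-○∨ ⇒-refl) (inr (by (○-mono ⇒◇) hyp)) (inr (by (○-mono ○◇⇒◇) hyp))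

⋁-singleton : ∀ {G φ} → G ▷ ⋁ (φ ∷ []) → G ▷ φ
⋁-singleton d = case d hyp (exfalso hyp)

cut : ∀ {G φ ψ} → ⊢ φ ∧ G ⇒ ψ → G ▷ φ ∨ ψ → G ▷ ψ
cut d φ∨ψ = case φ∨ψ (precompose (pair hyp (weaken ⇒-refl)) d) hyp

infix 4 _≟ᶠ_
_≟ᶠ_ : DecidableEquality Fm
⊥ᶠ ≟ᶠ ⊥ᶠ = yes refl
⊥ᶠ ≟ᶠ (var _) = no λ ()
⊥ᶠ ≟ᶠ (_ ∧ _) = no λ ()
⊥ᶠ ≟ᶠ (_ ∨ _) = no λ ()
⊥ᶠ ≟ᶠ (_ ⇒ _) = no λ ()
⊥ᶠ ≟ᶠ (○ _) = no λ ()
⊥ᶠ ≟ᶠ (◇ _) = no λ ()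
(var _) ≟ᶠ ⊥ᶠ = no λ ()
(var m) ≟ᶠ (var n) = map′ (cong var) (λ { refl → refl }) (m ℕ.≟ n)
(var _) ≟ᶠ (_ ∧ _) = no λ ()
(var _) ≟ᶠ (_ ∨ _) = no λ ()
(var _) ≟ᶠ (_ ⇒ _) = no λ ()
(var _) ≟ᶠ (○ _) = no λ ()
(var _) ≟ᶠ (◇ _) = no λ ()
(_ ∧ _) ≟ᶠ ⊥ᶠ = no λ ()
(_ ∧ _) ≟ᶠ (var _) = no λ ()
(φ ∧ ψ) ≟ᶠ (φ' ∧ ψ') = map′ (λ (p , q) → cong₂ _∧_ p q) (λ { refl → refl , refl }) (φ ≟ᶠ φ' ×-dec ψ ≟ᶠ ψ')
(_ ∧ _) ≟ᶠ (_ ∨ _) = no λ ()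
(_ ∧ _) ≟ᶠ (_ ⇒ _) = no λ ()
(_ ∧ _) ≟ᶠ (○ _) = no λ ()
(_ ∧ _) ≟ᶠ (◇ _) = no λ ()
(_ ∨ _) ≟ᶠ ⊥ᶠ = no λ ()
(_ ∨ _) ≟ᶠ (var _) = no λ ()
(_ ∨ _) ≟ᶠ (_ ∧ _) = no λ ()
(φ ∨ ψ) ≟ᶠ (φ' ∨ ψ') = map′ (λ (p , q) → cong₂ _∨_ p q) (λ { refl → refl , refl }) (φ ≟ᶠ φ' ×-dec ψ ≟ᶠ ψ')
(_ ∨ _) ≟ᶠ (_ ⇒ _) = no λ ()
(_ ∨ _) ≟ᶠ (○ _) = no λ ()
(_ ∨ _) ≟ᶠ (◇ _) = no λ ()
(_ ⇒ _) ≟ᶠ ⊥ᶠ = no λ ()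
(_ ⇒ _) ≟ᶠ (var _) = no λ ()
(_ ⇒ _) ≟ᶠ (_ ∧ _) = no λ ()
(_ ⇒ _) ≟ᶠ (_ ∨ _) = no λ ()
(φ ⇒ ψ) ≟ᶠ (φ' ⇒ ψ') = map′ (λ (p , q) → cong₂ _⇒_ p q) (λ { refl → refl , refl }) (φ ≟ᶠ φ' ×-dec ψ ≟ᶠ ψ')
(_ ⇒ _) ≟ᶠ (○ _) = no λ ()
(_ ⇒ _) ≟ᶠ (◇ _) = no λ ()
(○ _) ≟ᶠ ⊥ᶠ = no λ ()
(○ _) ≟ᶠ (var _) = no λ ()
(○ _) ≟ᶠ (_ ∧ _) = no λ ()
(○ _) ≟ᶠ (_ ∨ _) = no λ ()
(○ _) ≟ᶠ (_ ⇒ _) = no λ ()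
(○ φ) ≟ᶠ (○ φ') = map′ (cong ○_) (λ { refl → refl }) (φ ≟ᶠ φ')
(○ _) ≟ᶠ (◇ _) = no λ ()
(◇ _) ≟ᶠ ⊥ᶠ = no λ ()
(◇ _) ≟ᶠ (var _) = no λ ()
(◇ _) ≟ᶠ (_ ∧ _) = no λ ()
(◇ _) ≟ᶠ (_ ∨ _) = no λ ()
(◇ _) ≟ᶠ (_ ⇒ _) = no λ ()
(◇ _) ≟ᶠ (○ _) = no λ ()
(◇ φ) ≟ᶠ (◇ φ') = map′ (cong ◇_) (λ { refl → refl }) (φ ≟ᶠ φ')

open import Data.List.Membership.DecPropositional _≟ᶠ_ using (_∈?_)

Unique⇒lookup-injective : ∀ {A : Set} {xs : List A} {i j} → Unique xs → lookup xs i ≡ lookup xs j → i ≡ j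
Unique⇒lookup-injective {xs = _ ∷ _} {zero}  {zero}  _         _  = refl
Unique⇒lookup-injective {xs = _ ∷ _} {zero}  {suc j} (x∉ ∷ _)  eq = ⊥-elim (All.lookup x∉ (∈-lookup j) eq)
Unique⇒lookup-injective {xs = _ ∷ _} {suc i} {zero}  (x∉ ∷ _)  eq = ⊥-elim (All.lookup x∉ (∈-lookup i) (sym eq))
Unique⇒lookup-injective {xs = _ ∷ _} {suc i} {suc j} (_ ∷ xs!) eq = cong suc (Unique⇒lookup-injective xs! eq)

Unique⇒length≤ : ∀ {A : Set} {xs ys : List A} → Unique xs → (∀ {x} → x ∈ xs → x ∈ ys) → length xs ℕ.≤ length ys
Unique⇒length≤ {xs = xs} {ys} xs! xs⊆ys = injective⇒≤ position-injective
  where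
  position : Fin (length xs) → Fin (length ys)
  position i = Any.index (xs⊆ys (∈-lookup i))
  position-injective : ∀ {i j} → position i ≡ position j → i ≡ j
  position-injective {i} {j} eq = Unique⇒lookup-injective xs! (begin
    lookup xs i                ≡⟨ lookup-index (xs⊆ys (∈-lookup i)) ⟩
    lookup ys (position i)     ≡⟨ cong (lookup ys) eq ⟩
    lookup ys (position j)     ≡⟨ lookup-index (xs⊆ys (∈-lookup j)) ⟨
    lookup xs j                ∎)
    where open ≡-Reasoning

≼-refl : ∀ {t} (p : Pos t) → p ≼ p
≼-refl here        = here≼
≼-refl (child i p) = child≼ (≼-refl p)

≼-trans : ∀ {t} {p q r : Pos t} → p ≼ q → q ≼ r → p ≼ r
≼-trans here≼      _          = here≼
≼-trans (child≼ h) (child≼ h') = child≼ (≼-trans h h')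

≼-antisym : ∀ {t} {p q : Pos t} → p ≼ q → q ≼ p → p ≡ q
≼-antisym here≼      here≼       = refl
≼-antisym (child≼ h) (child≼ h') = cong (child _) (≼-antisym h h')

top-least : ∀ t (p : Pos t) → top t ≼ p
top-least (node ℓ cs) p = here≼

≼top⇒≡top : ∀ t {p : Pos t} → p ≼ top t → p ≡ top t
≼top⇒≡top (node ℓ cs) here≼ = refl

≼-reflecting⇒injective : ∀ {s t} {f : Pos s → Pos t} → (∀ {p q} → f p ≼ f q → p ≼ q) →
                         ∀ {p q} → f p ≡ f q → p ≡ q
≼-reflecting⇒injective {f = f} reflects {p} eq =
  ≼-antisym (reflects (subst (f p ≼_) eq (≼-refl _))) (reflects (subst (_≼ f p) eq (≼-refl _)))

infix 4 _≟ᴾ_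
_≟ᴾ_ : ∀ {t} → DecidableEquality (Pos t)
here      ≟ᴾ here        = yes refl
here      ≟ᴾ child _ _   = no λ ()
child _ _ ≟ᴾ here        = no λ ()
child i p ≟ᴾ child j q with i Fin.≟ j
... | no i≢j = no λ { refl → i≢j refl }
... | yes refl = map′ (cong (child i)) (λ { refl → refl }) (p ≟ᴾ q)

ChildPos : List Tree → Set
ChildPos cs = ∃ λ (i : Fin (length cs)) → Pos (lookup cs i)

toChild : ∀ {ℓ cs} → ChildPos cs → Pos (node ℓ cs)
toChild (i , p) = child i p

nextChild : ∀ {c cs} → ChildPos cs → ChildPos (c ∷ cs)
nextChild (i , p) = suc i , p

mutual
  positions : (t : Tree) → List (Pos t)
  positions (node ℓ cs) = here ∷ map toChild (childPositions cs)

  childPositions : (cs : List Tree) → List (ChildPos cs)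
  childPositions []       = []
  childPositions (c ∷ cs) = map (zero ,_) (positions c) ++ map nextChild (childPositions cs)

mutual
  ∈-positions : ∀ t (p : Pos t) → p ∈ positions t
  ∈-positions (node ℓ cs) here        = here refl
  ∈-positions (node ℓ cs) (child i p) = there (∈-map⁺ toChild (∈-childPositions cs i p))

  ∈-childPositions : ∀ cs i (p : Pos (lookup cs i)) → (i , p) ∈ childPositions cs
  ∈-childPositions (c ∷ cs) zero    p = ∈-++⁺ˡ (∈-map⁺ _ (∈-positions c p))
  ∈-childPositions (c ∷ cs) (suc i) p = ∈-++⁺ʳ _ (∈-map⁺ nextChild (∈-childPositions cs i p))

mutual
  positions-unique : ∀ t → Unique (positions t)
  positions-unique (node ℓ cs) =
    All.tabulate (λ { p∈ refl → here∉ (∈-map⁻ toChild p∈) })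
      ∷ Unique.map⁺ child-injective (childPositions-unique cs)
    where
    here∉ : ¬ ∃ λ ip → ip ∈ childPositions cs × here ≡ toChild ip
    here∉ (_ , _ , ())
    child-injective : ∀ {ip jq : ChildPos cs} → toChild {ℓ} ip ≡ toChild jq → ip ≡ jq
    child-injective {_ , _} {_ , _} refl = refl

  childPositions-unique : ∀ cs → Unique (childPositions cs)
  childPositions-unique []       = []
  childPositions-unique (c ∷ cs) =
    Unique.++⁺ (Unique.map⁺ (λ { refl → refl }) (positions-unique c))
               (Unique.map⁺ (λ { {_ , _} {_ , _} refl → refl }) (childPositions-unique cs))
               disjoint
    where
    disjoint : ∀ {ip} → ¬ (ip ∈ map (zero ,_) (positions c) × ip ∈ map nextChild (childPositions cs))
    disjoint (p∈ , q∈) with ∈-map⁻ (zero ,_) p∈ | ∈-map⁻ nextChild q∈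
    ... | _ , _ , refl | (_ , _) , _ , ()

size : Tree → ℕ
size t = length (positions t)

injective-missing⇒size< : ∀ {s t} (f : Pos s → Pos t) → (∀ {p q} → f p ≡ f q → p ≡ q) →
                          ∀ x → (∀ p → f p ≢ x) → size s ℕ.< size t
injective-missing⇒size< {s} {t} f f-injective x missed =
  subst (ℕ._≤ size t) (cong suc (length-map f (positions s)))
    (Unique⇒length≤ (All.tabulate (λ { x∈ refl → x∉ (∈-map⁻ f x∈) })
                       ∷ Unique.map⁺ f-injective (positions-unique s))
                    (λ {p} _ → ∈-positions t p))
  where
  x∉ : ¬ ∃ λ p → p ∈ positions s × x ≡ f p
  x∉ (p , _ , x≡fp) = missed p (sym x≡fp)

rootLabel : Tree → Label
rootLabel t = lab t (top t)

fromSub : ∀ t y → Pos (sub t y) → Pos t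
fromSub (node ℓ cs) here        r = r
fromSub (node ℓ cs) (child i y) r = child i (fromSub (lookup cs i) y r)

toSub : ∀ t y (z : Pos t) → y ≼ z → Pos (sub t y)
toSub (node ℓ cs) here        z           _          = z
toSub (node ℓ cs) (child i y) (child .i z) (child≼ h) = toSub (lookup cs i) y z h

fromSub-lab : ∀ t y r → lab (sub t y) r ≡ lab t (fromSub t y r)
fromSub-lab (node ℓ cs) here        r = refl
fromSub-lab (node ℓ cs) (child i y) r = fromSub-lab (lookup cs i) y r

fromSub-mono : ∀ t y {r r'} → r ≼ r' → fromSub t y r ≼ fromSub t y r'
fromSub-mono (node ℓ cs) here        h = h
fromSub-mono (node ℓ cs) (child i y) h = child≼ (fromSub-mono (lookup cs i) y h)

fromSub-reflects : ∀ t y {r r'} → fromSub t y r ≼ fromSub t y r' → r ≼ r'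
fromSub-reflects (node ℓ cs) here        h          = h
fromSub-reflects (node ℓ cs) (child i y) (child≼ h) = fromSub-reflects (lookup cs i) y h

fromSub-above : ∀ t y r → y ≼ fromSub t y r
fromSub-above (node ℓ cs) here        r = here≼
fromSub-above (node ℓ cs) (child i y) r = child≼ (fromSub-above (lookup cs i) y r)

fromSub-toSub : ∀ t y z (h : y ≼ z) → fromSub t y (toSub t y z h) ≡ z
fromSub-toSub (node ℓ cs) here        z           _          = refl
fromSub-toSub (node ℓ cs) (child i y) (child .i z) (child≼ h) = cong (child i) (fromSub-toSub (lookup cs i) y z h)

fromSub-top : ∀ t y → fromSub t y (top (sub t y)) ≡ y
fromSub-top (node ℓ cs) here        = refl
fromSub-top (node ℓ cs) (child i y) = cong (child i) (fromSub-top (lookup cs i) y)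

⋀∈⇒∈ : ∀ {Σ'} → SubClosed Σ' → ∀ φs {φ} → ⋀ φs ∈ Σ' → φ ∈ φs → φ ∈ Σ'
⋀∈⇒∈ cl (ψ ∷ φs) ∈Σ' (here refl) = cl ∧ˡ ∈Σ'
⋀∈⇒∈ cl (ψ ∷ φs) ∈Σ' (there φ∈) = ⋀∈⇒∈ cl φs (cl ∧ʳ ∈Σ') φ∈

⋁∈⇒∈ : ∀ {Σ'} → SubClosed Σ' → ∀ φs {φ} → ⋁ φs ∈ Σ' → φ ∈ φs → φ ∈ Σ'
⋁∈⇒∈ cl (ψ ∷ φs) ∈Σ' (here refl) = cl ∨ˡ ∈Σ'
⋁∈⇒∈ cl (ψ ∷ φs) ∈Σ' (there φ∈) = ⋁∈⇒∈ cl φs (cl ∨ʳ ∈Σ') φ∈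

mutual
  subformulas : Fm → List Fm
  subformulas χ = χ ∷ properSubformulas χ

  properSubformulas : Fm → List Fm
  properSubformulas ⊥ᶠ      = []
  properSubformulas (var _) = []
  properSubformulas (φ ∧ ψ) = subformulas φ ++ subformulas ψ
  properSubformulas (φ ∨ ψ) = subformulas φ ++ subformulas ψ
  properSubformulas (φ ⇒ ψ) = subformulas φ ++ subformulas ψ
  properSubformulas (○ φ)   = subformulas φ
  properSubformulas (◇ φ)   = subformulas φ

++-closed : ∀ {φs ψs} → SubClosed φs → SubClosed ψs → SubClosed (φs ++ ψs)
++-closed {φs} φs-closed ψs-closed s χ∈ with ∈-++⁻ φs χ∈
... | inj₁ χ∈φs = ∈-++⁺ˡ (φs-closed s χ∈φs)
... | inj₂ χ∈ψs = ∈-++⁺ʳ φs (ψs-closed s χ∈ψs)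

ImmSub⇒∈subformulas : ∀ {φ χ} → ImmSub φ χ → φ ∈ subformulas χ
ImmSub⇒∈subformulas (∧ˡ {ψ = ψ}) = there (∈-++⁺ˡ {ys = subformulas ψ} (here refl))
ImmSub⇒∈subformulas ∧ʳ = there (∈-++⁺ʳ (subformulas _) (here refl))
ImmSub⇒∈subformulas (∨ˡ {ψ = ψ}) = there (∈-++⁺ˡ {ys = subformulas ψ} (here refl))
ImmSub⇒∈subformulas ∨ʳ = there (∈-++⁺ʳ (subformulas _) (here refl))
ImmSub⇒∈subformulas (⇒ˡ {ψ = ψ}) = there (∈-++⁺ˡ {ys = subformulas ψ} (here refl))
ImmSub⇒∈subformulas ⇒ʳ = there (∈-++⁺ʳ (subformulas _) (here refl))
ImmSub⇒∈subformulas ○ˢ = there (here refl)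
ImmSub⇒∈subformulas ◇ˢ = there (here refl)

subformulas-closed : ∀ χ → SubClosed (subformulas χ)
subformulas-closed χ       s (here refl)   = ImmSub⇒∈subformulas s
subformulas-closed (φ ∧ ψ) s (there χ'∈)  = there (++-closed (subformulas-closed φ) (subformulas-closed ψ) s χ'∈)
subformulas-closed (φ ∨ ψ) s (there χ'∈)  = there (++-closed (subformulas-closed φ) (subformulas-closed ψ) s χ'∈)
subformulas-closed (φ ⇒ ψ) s (there χ'∈)  = there (++-closed (subformulas-closed φ) (subformulas-closed ψ) s χ'∈)
subformulas-closed (○ φ)   s (there χ'∈)  = there (subformulas-closed φ s χ'∈)
subformulas-closed (◇ φ)   s (there χ'∈)  = there (subformulas-closed φ s χ'∈)

closure-closed : ∀ {Σ} → SubClosed Σ → ∀ α β → SubClosed (Σ ++ subformulas α ++ subformulas β)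
closure-closed Σ-closed α β = ++-closed Σ-closed (++-closed (subformulas-closed α) (subformulas-closed β))

clash : ∀ {A : Set} {b : Bool} → b ≡ true → b ≡ false → A
clash refl ()

module Truth {Σ' : List Fm} (cl : SubClosed Σ') {m : Tree} (mm : IsMoment Σ' m) where
  open IsMoment mm

  false-downward : ∀ {p q} → p ≼ q → ∀ {φ} → φ ∈ Σ' → lab m q φ ≡ false → lab m p φ ≡ false
  false-downward p≼q φ∈ qφ = ¬-not λ pφ → clash (mono p≼q _ φ∈ pφ) qφ

  ⊤-true : ∀ {p} → ⊤ᶠ ∈ Σ' → lab m p ⊤ᶠ ≡ true
  ⊤-true {p} ⊤∈ = ¬-not λ p⊤ →
    let (q , _ , q⊥ , _) = witness p ⊤∈ p⊤ in clash q⊥ (IsType.bot (typed q) (cl ⇒ˡ ⊤∈))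

  ⋀-true⇒ : ∀ {p} φs {φ} → ⋀ φs ∈ Σ' → lab m p (⋀ φs) ≡ true → φ ∈ φs → lab m p φ ≡ true
  ⋀-true⇒ {p} (ψ ∷ φs) ∈Σ' t (here refl) = proj₁ (IsType.and⁺ (typed p) ∈Σ' t)
  ⋀-true⇒ {p} (ψ ∷ φs) ∈Σ' t (there φ∈) = ⋀-true⇒ φs (cl ∧ʳ ∈Σ') (proj₂ (IsType.and⁺ (typed p) ∈Σ' t)) φ∈

  ⋀-true⇐ : ∀ {p} φs → ⋀ φs ∈ Σ' → (∀ {φ} → φ ∈ φs → lab m p φ ≡ true) → lab m p (⋀ φs) ≡ true
  ⋀-true⇐ []             ∈Σ' _ = ⊤-true ∈Σ'
  ⋀-true⇐ {p} (φ ∷ φs) ∈Σ' t = IsType.and⁻ (typed p) ∈Σ' (t (here refl)) (⋀-true⇐ φs (cl ∧ʳ ∈Σ') (t ∘ there))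

  ⋁-true⇒ : ∀ {p} φs → ⋁ φs ∈ Σ' → lab m p (⋁ φs) ≡ true → ∃ λ φ → φ ∈ φs × lab m p φ ≡ true
  ⋁-true⇒ {p} []       ∈Σ' t = clash t (IsType.bot (typed p) ∈Σ')
  ⋁-true⇒ {p} (φ ∷ φs) ∈Σ' t with IsType.or⁺ (typed p) ∈Σ' t
  ... | inj₁ tφ  = φ , here refl , tφ
  ... | inj₂ tφs = let (ψ , ψ∈ , tψ) = ⋁-true⇒ φs (cl ∨ʳ ∈Σ') tφs in ψ , there ψ∈ , tψ

  ⋁-true⇐ : ∀ {p} φs {φ} → ⋁ φs ∈ Σ' → φ ∈ φs → lab m p φ ≡ true → lab m p (⋁ φs) ≡ true
  ⋁-true⇐ {p} (ψ ∷ φs) ∈Σ' (here refl) t = IsType.or⁻ (typed p) ∈Σ' (inj₁ t)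
  ⋁-true⇐ {p} (ψ ∷ φs) ∈Σ' (there φ∈) t = IsType.or⁻ (typed p) ∈Σ' (inj₂ (⋁-true⇐ φs (cl ∨ʳ ∈Σ') φ∈ t))

  ⋁-false⇒ : ∀ {p} φs {φ} → ⋁ φs ∈ Σ' → lab m p (⋁ φs) ≡ false → φ ∈ φs → lab m p φ ≡ false
  ⋁-false⇒ φs ∈Σ' f φ∈ = ¬-not λ t → clash (⋁-true⇐ φs ∈Σ' φ∈ t) f

  ⋁-false⇐ : ∀ {p} φs → ⋁ φs ∈ Σ' → (∀ {φ} → φ ∈ φs → lab m p φ ≡ false) → lab m p (⋁ φs) ≡ false
  ⋁-false⇐ φs ∈Σ' f = ¬-not λ t → let (φ , φ∈ , tφ) = ⋁-true⇒ φs ∈Σ' t in clash tφ (f φ∈)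

  ∨-falseˡ : ∀ {p φ ψ} → φ ∨ ψ ∈ Σ' → lab m p (φ ∨ ψ) ≡ false → lab m p φ ≡ false
  ∨-falseˡ {p} ∈Σ' f = ¬-not λ t → clash (IsType.or⁻ (typed p) ∈Σ' (inj₁ t)) f

  ∨-falseʳ : ∀ {p φ ψ} → φ ∨ ψ ∈ Σ' → lab m p (φ ∨ ψ) ≡ false → lab m p ψ ≡ false
  ∨-falseʳ {p} ∈Σ' f = ¬-not λ t → clash (IsType.or⁻ (typed p) ∈Σ' (inj₂ t)) f

  ∨-false : ∀ {p φ ψ} → φ ∨ ψ ∈ Σ' → lab m p φ ≡ false → lab m p ψ ≡ false → lab m p (φ ∨ ψ) ≡ false
  ∨-false {p} ∈Σ' fφ fψ = ¬-not λ t → [ flip clash fφ , flip clash fψ ] (IsType.or⁺ (typed p) ∈Σ' t)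

  ⇒-false : ∀ {p φ ψ} → φ ⇒ ψ ∈ Σ' → lab m p φ ≡ true → lab m p ψ ≡ false → lab m p (φ ⇒ ψ) ≡ false
  ⇒-false {p} ∈Σ' tφ fψ = ¬-not λ t → [ clash tφ , flip clash fψ ] (IsType.imp (typed p) ∈Σ' t)

-- For requirement lists P and M, the formula char t is refuted at y exactly when t embeds
-- monotonically above y, each node p going to a point where P (ℓ p) holds and M (ℓ p) fails.
-- Sim is the instance P = plus Σ, M = minus Σ.
module Characteristic (P M : Label → List Fm) where
  mutual
    char : Tree → Fm
    char (node ℓ cs) = ⋀ (P ℓ) ⇒ (⋁ (M ℓ) ∨ ⋁ (charDesc cs))

    charDesc : List Tree → List Fm
    charDesc []       = []
    charDesc (c ∷ cs) = char c ∷ (charBelow c ++ charDesc cs)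

    charBelow : Tree → List Fm
    charBelow (node ℓ ds) = charDesc ds

  module _ {Σ' : List Fm} (cl : SubClosed Σ') {m : Tree} (mm : IsMoment Σ' m) where
    open IsMoment mm using (witness)
    open Truth cl mm

    MeetsAt : Label → Pos m → Set
    MeetsAt ℓ x = (∀ {φ} → φ ∈ P ℓ → lab m x φ ≡ true) × (∀ {φ} → φ ∈ M ℓ → lab m x φ ≡ false)

    record Embedding (t : Tree) (y : Pos m) : Set where
      field
        emb   : Pos t → Pos m
        above : y ≼ emb (top t)
        mono  : ∀ {p q} → p ≼ q → emb p ≼ emb q
        meets : ∀ p → MeetsAt (lab t p) (emb p)

    open Embedding

    childEmbedding : ∀ {ℓ cs y} (E : Embedding (node ℓ cs) y) i → Embedding (lookup cs i) (emb E here)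
    childEmbedding E i = record
      { emb = emb E ∘ child i ; above = mono E here≼ ; mono = mono E ∘ child≼ ; meets = meets E ∘ child i }

    nodeEmbedding : ∀ {ℓ cs y q} → y ≼ q → MeetsAt ℓ q → (∀ i → Embedding (lookup cs i) q) →
                    Embedding (node ℓ cs) y
    nodeEmbedding {ℓ} {cs} {y} {q} y≼q meets-q E =
      record { emb = e ; above = y≼q ; mono = e-mono ; meets = e-meets }
      where
      e : Pos (node ℓ cs) → Pos m
      e here        = q
      e (child i p) = emb (E i) p
      e-mono : ∀ {p p'} → p ≼ p' → e p ≼ e p'
      e-mono {here}      {here}       _          = ≼-refl q
      e-mono {here}      {child i p}  _          = ≼-trans (above (E i)) (mono (E i) (top-least _ p))
      e-mono {child i p} {child .i p'} (child≼ h) = mono (E i) h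
      e-meets : ∀ p → MeetsAt (lab (node ℓ cs) p) (e p)
      e-meets here        = meets-q
      e-meets (child i p) = meets (E i) p

    mutual
      refuted⇒embeds : ∀ t {y} → char t ∈ Σ' → lab m y (char t) ≡ false → Embedding t y
      refuted⇒embeds (node ℓ cs) {y} ∈Σ' refuted with witness y ∈Σ' refuted
      ... | q , y≼q , ⋀P-true , conclusion-false =
        nodeEmbedding y≼q
          (⋀-true⇒ (P ℓ) (cl ⇒ˡ ∈Σ') ⋀P-true , ⋁-false⇒ (M ℓ) (cl ∨ˡ ∈Σ'ᶜ) (∨-falseˡ ∈Σ'ᶜ conclusion-false))
          (charDesc-refuted⇒embeds cs (⋁∈⇒∈ cl (charDesc cs) (cl ∨ʳ ∈Σ'ᶜ))
                                      (⋁-false⇒ (charDesc cs) (cl ∨ʳ ∈Σ'ᶜ) (∨-falseʳ ∈Σ'ᶜ conclusion-false)))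
        where
        ∈Σ'ᶜ : ⋁ (M ℓ) ∨ ⋁ (charDesc cs) ∈ Σ'
        ∈Σ'ᶜ = cl ⇒ʳ ∈Σ'

      charDesc-refuted⇒embeds : ∀ cs {q} → (∀ {φ} → φ ∈ charDesc cs → φ ∈ Σ') →
                                (∀ {φ} → φ ∈ charDesc cs → lab m q φ ≡ false) → ∀ i → Embedding (lookup cs i) q
      charDesc-refuted⇒embeds (c ∷ cs) ∈Σ' f zero    = refuted⇒embeds c (∈Σ' (here refl)) (f (here refl))
      charDesc-refuted⇒embeds (c ∷ cs) ∈Σ' f (suc i) =
        charDesc-refuted⇒embeds cs (λ φ∈ → ∈Σ' (there (∈-++⁺ʳ (charBelow c) φ∈)))
                                   (λ φ∈ → f (there (∈-++⁺ʳ (charBelow c) φ∈))) i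

    mutual
      embeds⇒refuted : ∀ t {y} → char t ∈ Σ' → (E : Embedding t y) → lab m (emb E (top t)) (char t) ≡ false
      embeds⇒refuted (node ℓ cs) ∈Σ' E =
        ⇒-false ∈Σ' (⋀-true⇐ (P ℓ) (cl ⇒ˡ ∈Σ') (proj₁ (meets E here)))
          (∨-false ∈Σ'ᶜ (⋁-false⇐ (M ℓ) (cl ∨ˡ ∈Σ'ᶜ) (proj₂ (meets E here)))
                        (⋁-false⇐ (charDesc cs) (cl ∨ʳ ∈Σ'ᶜ)
                          (embeddings⇒charDesc-refuted cs (⋁∈⇒∈ cl (charDesc cs) (cl ∨ʳ ∈Σ'ᶜ))
                                                          (childEmbedding E))))
        where
        ∈Σ'ᶜ : ⋁ (M ℓ) ∨ ⋁ (charDesc cs) ∈ Σ'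
        ∈Σ'ᶜ = cl ⇒ʳ ∈Σ'

      embeddings⇒charDesc-refuted : ∀ cs {q} → (∀ {φ} → φ ∈ charDesc cs → φ ∈ Σ') →
                                    (∀ i → Embedding (lookup cs i) q) →
                                    ∀ {φ} → φ ∈ charDesc cs → lab m q φ ≡ false
      embeddings⇒charDesc-refuted (c ∷ cs) ∈Σ' E (here refl) =
        false-downward (above (E zero)) (∈Σ' (here refl)) (embeds⇒refuted c (∈Σ' (here refl)) (E zero))
      embeddings⇒charDesc-refuted (node ℓ ds ∷ cs) ∈Σ' E (there φ∈) with ∈-++⁻ (charDesc ds) φ∈
      ... | inj₁ φ∈ds = false-downward (above (E zero)) (∈Σ' (there φ∈))
                          (embeddings⇒charDesc-refuted ds (λ ψ∈ → ∈Σ' (there (∈-++⁺ˡ ψ∈)))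
                                                          (childEmbedding (E zero)) φ∈ds)
      ... | inj₂ φ∈cs =
        embeddings⇒charDesc-refuted cs (λ ψ∈ → ∈Σ' (there (∈-++⁺ʳ (charDesc ds) ψ∈))) (E ∘ suc) φ∈cs

holds : List Fm → Label
holds A φ = does (φ ∈? A)

∈⇒holds : ∀ {A φ} → φ ∈ A → holds A φ ≡ true
∈⇒holds {A} {φ} = dec-true (φ ∈? A)

∉⇒¬holds : ∀ {A φ} → ¬ φ ∈ A → holds A φ ≡ false
∉⇒¬holds {A} {φ} = dec-false (φ ∈? A)

holds⇒∈ : ∀ {A φ} → holds A φ ≡ true → φ ∈ A
holds⇒∈ {A} {φ} h with φ ∈? A
... | yes φ∈ = φ∈
holds⇒∈ () | no _

unfixed : List Fm → List Fm → ℕ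
unfixed []       A = 0
unfixed (φ ∷ Σ') A = if holds A φ then unfixed Σ' A else suc (unfixed Σ' A)

unfixed≤length : ∀ Σ' A → unfixed Σ' A ℕ.≤ length Σ'
unfixed≤length []       A = z≤n
unfixed≤length (φ ∷ Σ') A with holds A φ
... | true  = m≤n⇒m≤1+n (unfixed≤length Σ' A)
... | false = s≤s (unfixed≤length Σ' A)

unfixed-antitone : ∀ Σ' {A A'} → (∀ {φ} → φ ∈ A → φ ∈ A') → unfixed Σ' A' ℕ.≤ unfixed Σ' A
unfixed-antitone []       _ = z≤n
unfixed-antitone (φ ∷ Σ') {A} {A'} A⊆A' with φ ∈? A | φ ∈? A'
... | yes φ∈A | no φ∉A' = ⊥-elim (φ∉A' (A⊆A' φ∈A))
... | yes _   | yes _   = unfixed-antitone Σ' A⊆A'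
... | no _    | yes _   = m≤n⇒m≤1+n (unfixed-antitone Σ' A⊆A')
... | no _    | no _    = s≤s (unfixed-antitone Σ' A⊆A')

unfixed-decreasing : ∀ Σ' {A A' φ} → (∀ {ψ} → ψ ∈ A → ψ ∈ A') → φ ∈ Σ' → ¬ φ ∈ A → φ ∈ A' →
                     unfixed Σ' A' ℕ.< unfixed Σ' A
unfixed-decreasing (ψ ∷ Σ') {A} {A'} A⊆A' (here refl) φ∉A φ∈A' with ψ ∈? A | ψ ∈? A'
... | yes φ∈A | _       = ⊥-elim (φ∉A φ∈A)
... | no _    | no φ∉A' = ⊥-elim (φ∉A' φ∈A')
... | no _    | yes _   = s≤s (unfixed-antitone Σ' A⊆A')
unfixed-decreasing (ψ ∷ Σ') {A} {A'} A⊆A' (there φ∈) φ∉A φ∈A' with ψ ∈? A | ψ ∈? A'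
... | yes ψ∈A | no ψ∉A' = ⊥-elim (ψ∉A' (A⊆A' ψ∈A))
... | yes _   | yes _   = unfixed-decreasing Σ' A⊆A' φ∈ φ∉A φ∈A'
... | no _    | yes _   = m≤n⇒m≤1+n (unfixed-decreasing Σ' A⊆A' φ∈ φ∉A φ∈A')
... | no _    | no _    = s≤s (unfixed-decreasing Σ' A⊆A' φ∈ φ∉A φ∈A')

Coherent : Label → Fm → Set
Coherent ℓ ⊥ᶠ      = ℓ ⊥ᶠ ≡ false
Coherent ℓ (var _) = ⊤
Coherent ℓ (φ ∧ ψ) = (ℓ (φ ∧ ψ) ≡ true → ℓ φ ≡ true × ℓ ψ ≡ true) × (ℓ φ ≡ true → ℓ ψ ≡ true → ℓ (φ ∧ ψ) ≡ true)
Coherent ℓ (φ ∨ ψ) = (ℓ (φ ∨ ψ) ≡ true → ℓ φ ≡ true ⊎ ℓ ψ ≡ true) × (ℓ φ ≡ true ⊎ ℓ ψ ≡ true → ℓ (φ ∨ ψ) ≡ true)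
Coherent ℓ (φ ⇒ ψ) = ℓ (φ ⇒ ψ) ≡ true → ℓ φ ≡ false ⊎ ℓ ψ ≡ true
Coherent ℓ (○ _)   = ⊤
Coherent ℓ (◇ φ)   = ℓ (◇ φ) ≡ false → ℓ φ ≡ false

coherent⇒IsType : ∀ {Σ' ℓ} → (∀ {φ} → φ ∈ Σ' → Coherent ℓ φ) → IsType Σ' ℓ
coherent⇒IsType coh = record
  { bot  = coh
  ; and⁺ = proj₁ ∘ coh
  ; and⁻ = proj₂ ∘ coh
  ; or⁺  = proj₁ ∘ coh
  ; or⁻  = proj₂ ∘ coh
  ; imp  = coh
  ; dia  = coh
  }

module Completeness {Σ' : List Fm} (cl : SubClosed Σ') where

  data Outcome (A B : List Fm) : Set where
    derivable    : ⊢ ⋀ A ⇒ ⋁ B → Outcome A B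
    countermodel : (m : Tree) → IsMoment Σ' m →
                   (∀ {φ} → φ ∈ A → rootLabel m φ ≡ true) →
                   (∀ {φ} → φ ∈ B → rootLabel m φ ≡ false) → Outcome A B

  module Leaf (A B : List Fm) (covers : ∀ {φ} → φ ∈ Σ' → φ ∈ A ⊎ φ ∈ B)
              (subsearch : ∀ {φ} ψ → φ ∈ Σ' → ¬ φ ∈ A → Outcome (φ ∷ A) (ψ ∷ [])) where
    ℓ : Label
    ℓ = holds A

    Derivable : Set
    Derivable = ⊢ ⋀ A ⇒ ⋁ B

    assumed : ∀ {φ} → φ ∈ A → ⋀ A ▷ φ
    assumed = ⋀-elim

    refuting : ∀ {φ} → φ ∈ B → ⋀ A ▷ φ → Derivable
    refuting φ∈B d = by (⋁-intro φ∈B) d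

    data Side (φ : Fm) : Set where
      inA : φ ∈ A → ℓ φ ≡ true → Side φ
      inB : φ ∈ B → ℓ φ ≡ false → Side φ

    side : ∀ {φ} → φ ∈ Σ' → Side φ
    side {φ} φ∈ with φ ∈? A | covers φ∈
    ... | yes φ∈A | _         = inA φ∈A (∈⇒holds φ∈A)
    ... | no φ∉A  | inj₁ φ∈A = ⊥-elim (φ∉A φ∈A)
    ... | no φ∉A  | inj₂ φ∈B = inB φ∈B (∉⇒¬holds φ∉A)

    coherent-∧ : ∀ {φ ψ} → Side (φ ∧ ψ) → Side φ → Side ψ → Derivable ⊎ Coherent ℓ (φ ∧ ψ)
    coherent-∧ (inA ∧∈ t) (inA _ tφ)  (inA _ tψ)  = inj₂ ((λ _ → tφ , tψ) , (λ _ _ → t))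
    coherent-∧ (inA ∧∈ _) (inA _ _)   (inB ψ∈ _)  = inj₁ (refuting ψ∈ (by ax-∧E₂ (assumed ∧∈)))
    coherent-∧ (inA ∧∈ _) (inB φ∈ _)  _           = inj₁ (refuting φ∈ (by ax-∧E₁ (assumed ∧∈)))
    coherent-∧ (inB ∧∈ _) (inA φ∈ _)  (inA ψ∈ _)  = inj₁ (refuting ∧∈ (pair (assumed φ∈) (assumed ψ∈)))
    coherent-∧ (inB _ f)  (inA _ _)   (inB _ fψ)  = inj₂ (flip clash f , λ _ → flip clash fψ)
    coherent-∧ (inB _ f)  (inB _ fφ)  _           = inj₂ (flip clash f , λ tφ _ → clash tφ fφ)

    coherent-∨ : ∀ {φ ψ} → Side (φ ∨ ψ) → Side φ → Side ψ → Derivable ⊎ Coherent ℓ (φ ∨ ψ)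
    coherent-∨ (inA _ t)  (inA _ tφ)  _           = inj₂ ((λ _ → inj₁ tφ) , (λ _ → t))
    coherent-∨ (inA _ t)  (inB _ _)   (inA _ tψ)  = inj₂ ((λ _ → inj₂ tψ) , (λ _ → t))
    coherent-∨ (inA ∨∈ _) (inB φ∈ _)  (inB ψ∈ _)  =
      inj₁ (case (assumed ∨∈) (by (⋁-intro φ∈) hyp) (by (⋁-intro ψ∈) hyp))
    coherent-∨ (inB ∨∈ _) (inA φ∈ _)  _           = inj₁ (refuting ∨∈ (inl (assumed φ∈)))
    coherent-∨ (inB ∨∈ _) (inB _ _)   (inA ψ∈ _)  = inj₁ (refuting ∨∈ (inr (assumed ψ∈)))
    coherent-∨ (inB _ f)  (inB _ fφ)  (inB _ fψ)  = inj₂ (flip clash f , [ flip clash fφ , flip clash fψ ])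

    coherent-⇒ : ∀ {φ ψ} → Side (φ ⇒ ψ) → Side φ → Side ψ → Derivable ⊎ Coherent ℓ (φ ⇒ ψ)
    coherent-⇒ (inB _ f)  _           _          = inj₂ (flip clash f)
    coherent-⇒ (inA _ _)  (inB _ fφ)  _          = inj₂ (λ _ → inj₁ fφ)
    coherent-⇒ (inA _ _)  (inA _ _)   (inA _ tψ) = inj₂ (λ _ → inj₂ tψ)
    coherent-⇒ (inA ⇒∈ _) (inA φ∈ _)  (inB ψ∈ _) = inj₁ (refuting ψ∈ (assumed ⇒∈ · assumed φ∈))

    coherent-◇ : ∀ {φ} → Side (◇ φ) → Side φ → Derivable ⊎ Coherent ℓ (◇ φ)
    coherent-◇ (inA _ t)  _          = inj₂ (λ f → clash t f)
    coherent-◇ (inB _ _)  (inB _ fφ) = inj₂ (λ _ → fφ)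
    coherent-◇ (inB ◇∈ _) (inA φ∈ _) = inj₁ (refuting ◇∈ (by ⇒◇ (assumed φ∈)))

    coherent : ∀ φ → φ ∈ Σ' → Derivable ⊎ Coherent ℓ φ
    coherent ⊥ᶠ φ∈ with side φ∈
    ... | inA ⊥∈ _ = inj₁ (exfalso (assumed ⊥∈))
    ... | inB _ f  = inj₂ f
    coherent (var _) _  = inj₂ tt
    coherent (φ ∧ ψ) φ∈ = coherent-∧ (side φ∈) (side (cl ∧ˡ φ∈)) (side (cl ∧ʳ φ∈))
    coherent (φ ∨ ψ) φ∈ = coherent-∨ (side φ∈) (side (cl ∨ˡ φ∈)) (side (cl ∨ʳ φ∈))
    coherent (φ ⇒ ψ) φ∈ = coherent-⇒ (side φ∈) (side (cl ⇒ˡ φ∈)) (side (cl ⇒ʳ φ∈))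
    coherent (○ _)   _  = inj₂ tt
    coherent (◇ φ)   φ∈ = coherent-◇ (side φ∈) (side (cl ◇ˢ φ∈))

    coherent-all : ∀ φs → (∀ {φ} → φ ∈ φs → φ ∈ Σ') → Derivable ⊎ (∀ {φ} → φ ∈ φs → Coherent ℓ φ)
    coherent-all []       _  = inj₂ λ ()
    coherent-all (φ ∷ φs) ⊆Σ' with coherent φ (⊆Σ' (here refl)) | coherent-all φs (⊆Σ' ∘ there)
    ... | inj₁ d   | _         = inj₁ d
    ... | inj₂ _   | inj₁ d    = inj₁ d
    ... | inj₂ coh | inj₂ cohs = inj₂ λ { (here refl) → coh ; (there φ∈) → cohs φ∈ }

    ImpWitness : List Tree → Fm → Fm → Set
    ImpWitness cs φ ψ = (ℓ φ ≡ true × ℓ ψ ≡ false)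
                      ⊎ ∃ λ i → rootLabel (lookup cs i) φ ≡ true × rootLabel (lookup cs i) ψ ≡ false

    record Children (φs : List Fm) : Set where
      field
        trees     : List Tree
        moments   : ∀ i → IsMoment Σ' (lookup trees i)
        extend    : ∀ i {φ} → φ ∈ A → rootLabel (lookup trees i) φ ≡ true
        witnessed : ∀ {φ ψ} → φ ⇒ ψ ∈ φs → ℓ (φ ⇒ ψ) ≡ false → ImpWitness trees φ ψ

    noChildren : Children []
    noChildren = record { trees = [] ; moments = λ () ; extend = λ () ; witnessed = λ () }

    witnessedAtRoot : ∀ {χ φs} → (∀ {φ ψ} → φ ⇒ ψ ≡ χ → ℓ (φ ⇒ ψ) ≡ false → ℓ φ ≡ true × ℓ ψ ≡ false) →
                      Children φs → Children (χ ∷ φs)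
    witnessedAtRoot atRoot K = record
      { trees     = trees
      ; moments   = moments
      ; extend    = extend
      ; witnessed = λ { (here eq) f → inj₁ (atRoot eq f) ; (there ⇒∈) f → witnessed ⇒∈ f }
      }
      where open Children K

    addChild : ∀ {φ ψ φs} → Children φs → (c : Tree) → IsMoment Σ' c → (∀ {χ} → χ ∈ A → rootLabel c χ ≡ true) →
               rootLabel c φ ≡ true → rootLabel c ψ ≡ false → Children ((φ ⇒ ψ) ∷ φs)
    addChild K c c-moment c-extends tφ fψ = record
      { trees     = c ∷ trees
      ; moments   = λ { zero → c-moment ; (suc i) → moments i }
      ; extend    = λ { zero → c-extends ; (suc i) → extend i }
      ; witnessed = λ { (here refl) _ → inj₂ (zero , tφ , fψ)
                      ; (there ⇒∈) f → Sum.map₂ (λ (i , w) → suc i , w) (witnessed ⇒∈ f) }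
      }
      where open Children K

    build : IsType Σ' ℓ → Children Σ' → (∀ {φ} → φ ∈ B → ¬ φ ∈ A) → Outcome A B
    build ℓ-type K disjoint = countermodel (node ℓ trees) moment ∈⇒holds (∉⇒¬holds ∘ disjoint)
      where
      open Children K
      typed : ∀ p → IsType Σ' (lab (node ℓ trees) p)
      typed here        = ℓ-type
      typed (child i p) = IsMoment.typed (moments i) p
      mono : ∀ {p q} → p ≼ q → ∀ φ → φ ∈ Σ' → lab (node ℓ trees) p φ ≡ true → lab (node ℓ trees) q φ ≡ true
      mono {here}      {here}       _          _ _  t = t
      mono {here}      {child i q}  _          φ φ∈ t =
        IsMoment.mono (moments i) (top-least _ q) φ φ∈ (extend i (holds⇒∈ t))
      mono {child i p} {child .i q} (child≼ h) = IsMoment.mono (moments i) h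
      witness : ∀ p {φ ψ} → φ ⇒ ψ ∈ Σ' → lab (node ℓ trees) p (φ ⇒ ψ) ≡ false →
                ∃ λ q → p ≼ q × lab (node ℓ trees) q φ ≡ true × lab (node ℓ trees) q ψ ≡ false
      witness here ⇒∈ f with witnessed ⇒∈ f
      ... | inj₁ (tφ , fψ)     = here , here≼ , tφ , fψ
      ... | inj₂ (i , tφ , fψ) = child i (top (lookup trees i)) , here≼ , tφ , fψ
      witness (child i p) ⇒∈ f =
        let (q , p≼q , tφ , fψ) = IsMoment.witness (moments i) p ⇒∈ f in child i q , child≼ p≼q , tφ , fψ
      moment : IsMoment Σ' (node ℓ trees)
      moment = record { typed = typed ; mono = mono ; witness = witness }

    witness-⇒ : ∀ {φ ψ φs} → Side (φ ⇒ ψ) → Side ψ → φ ∈ Σ' → Side φ → Children φs →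
                Derivable ⊎ Children ((φ ⇒ ψ) ∷ φs)
    witness-⇒ (inA _ t)  _          _  _          K = inj₂ (witnessedAtRoot (λ { refl f → clash t f }) K)
    witness-⇒ (inB ⇒∈ _) (inA ψ∈ _) _  _          K = inj₁ (refuting ⇒∈ (by ax-K (assumed ψ∈)))
    witness-⇒ (inB _ _)  (inB _ fψ) _  (inA _ tφ) K = inj₂ (witnessedAtRoot (λ { refl _ → tφ , fψ }) K)
    witness-⇒ {ψ = ψ} (inB ⇒∈ _) (inB _ _) φ∈ (inB _ fφ) K
      with subsearch ψ φ∈ (λ φ∈A → clash (∈⇒holds φ∈A) fφ)
    ... | derivable d =
      inj₁ (refuting ⇒∈ (abs (⋁-singleton (precompose (pair hyp (weaken ⇒-refl)) d))))
    ... | countermodel m mm tA fB = inj₂ (addChild K m mm (tA ∘ there) (tA (here refl)) (fB (here refl)))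

    witnessFor : ∀ χ → χ ∈ Σ' → ∀ {φs} → Children φs → Derivable ⊎ Children (χ ∷ φs)
    witnessFor (φ ⇒ ψ) ⇒∈ K = witness-⇒ (side ⇒∈) (side (cl ⇒ʳ ⇒∈)) (cl ⇒ˡ ⇒∈) (side (cl ⇒ˡ ⇒∈)) K
    witnessFor ⊥ᶠ      _  K = inj₂ (witnessedAtRoot (λ ()) K)
    witnessFor (var _) _  K = inj₂ (witnessedAtRoot (λ ()) K)
    witnessFor (_ ∧ _) _  K = inj₂ (witnessedAtRoot (λ ()) K)
    witnessFor (_ ∨ _) _  K = inj₂ (witnessedAtRoot (λ ()) K)
    witnessFor (○ _)   _  K = inj₂ (witnessedAtRoot (λ ()) K)
    witnessFor (◇ _)   _  K = inj₂ (witnessedAtRoot (λ ()) K)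

    children : ∀ φs → (∀ {φ} → φ ∈ φs → φ ∈ Σ') → Derivable ⊎ Children φs
    children []       _   = inj₂ noChildren
    children (χ ∷ φs) ⊆Σ' with children φs (⊆Σ' ∘ there)
    ... | inj₁ d = inj₁ d
    ... | inj₂ K = witnessFor χ (⊆Σ' (here refl)) K

    outcome : Outcome A B
    outcome with Any.any? (_∈? A) B
    ... | yes shared = let (φ , φ∈B , φ∈A) = find shared in derivable (refuting φ∈B (assumed φ∈A))
    ... | no disjoint with coherent-all Σ' id | children Σ' id
    ...   | inj₁ d   | _      = derivable d
    ...   | inj₂ _   | inj₁ d = derivable d
    ...   | inj₂ coh | inj₂ K = build (coherent⇒IsType coh) K (λ φ∈B φ∈A → disjoint (lose φ∈B φ∈A))

  Covers : List Fm → List Fm → List Fm → Set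
  Covers A B R = ∀ {φ} → φ ∈ Σ' → φ ∈ A ⊎ φ ∈ B ⊎ φ ∈ R

  covers-assume : ∀ {A B χ R} → Covers A B (χ ∷ R) → Covers (χ ∷ A) B R
  covers-assume cov φ∈ with cov φ∈
  ... | inj₁ φ∈A                = inj₁ (there φ∈A)
  ... | inj₂ (inj₁ φ∈B)         = inj₂ (inj₁ φ∈B)
  ... | inj₂ (inj₂ (here refl)) = inj₁ (here refl)
  ... | inj₂ (inj₂ (there φ∈R)) = inj₂ (inj₂ φ∈R)

  covers-refute : ∀ {A B χ R} → Covers A B (χ ∷ R) → Covers A (χ ∷ B) R
  covers-refute cov φ∈ with cov φ∈
  ... | inj₁ φ∈A                = inj₁ φ∈A
  ... | inj₂ (inj₁ φ∈B)         = inj₂ (inj₁ (there φ∈B))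
  ... | inj₂ (inj₂ (here refl)) = inj₂ (inj₁ (here refl))
  ... | inj₂ (inj₂ (there φ∈R)) = inj₂ (inj₂ φ∈R)

  covers-settled : ∀ {A B} → Covers A B [] → ∀ {φ} → φ ∈ Σ' → φ ∈ A ⊎ φ ∈ B
  covers-settled cov φ∈ = Sum.map₂ [ id , (λ ()) ] (cov φ∈)

  -- The search splits every formula of Σ' into assumed (A) or refuted (B); at a leaf, each
  -- refuted implication whose antecedent is not yet assumed starts a subsearch with a strictly
  -- larger A, so the number of unfixed formulas bounds the depth.
  mutual
    search : ∀ k A B R → unfixed Σ' A ℕ.≤ k → Covers A B R → Outcome A B
    search k A B (χ ∷ R) bound cov
      with search k (χ ∷ A) B R (≤-trans (unfixed-antitone Σ' there) bound) (covers-assume cov)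
    ... | countermodel m mm tA fB = countermodel m mm (tA ∘ there) fB
    ... | derivable d₁ with search k A (χ ∷ B) R bound (covers-refute cov)
    ...   | countermodel m mm tA fB = countermodel m mm tA (fB ∘ there)
    ...   | derivable d₂            = derivable (cut d₁ d₂)
    search k A B [] bound cov = Leaf.outcome A B (covers-settled cov)
      (λ ψ φ∈ φ∉A → subsearch k A ψ (<-≤-trans (unfixed-decreasing Σ' there φ∈ φ∉A (here refl)) bound))

    subsearch : ∀ k A {φ} ψ → unfixed Σ' (φ ∷ A) ℕ.< k → Outcome (φ ∷ A) (ψ ∷ [])
    subsearch (suc k) A {φ} ψ (s≤s bound) = search k (φ ∷ A) (ψ ∷ []) Σ' bound (inj₂ ∘ inj₂)

  decide : ∀ α β → Outcome (α ∷ []) (β ∷ [])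
  decide α β = search (length Σ') (α ∷ []) (β ∷ []) Σ' (unfixed≤length Σ' (α ∷ [])) (inj₂ ∘ inj₂)

record Countermodel (Σ : List Fm) (α β : Fm) : Set where
  field
    Σ⁺      : List Fm
    closed  : SubClosed Σ⁺
    Σ⊆Σ⁺    : ∀ {φ} → φ ∈ Σ → φ ∈ Σ⁺
    α∈      : α ∈ Σ⁺
    β∈      : β ∈ Σ⁺
    model   : Tree
    moment  : IsMoment Σ⁺ model
    α-true  : rootLabel model α ≡ true
    β-false : rootLabel model β ≡ false

completeness : ∀ {Σ} → SubClosed Σ → ∀ α β → ¬ Countermodel Σ α β → ⊢ α ⇒ β
completeness {Σ} Σ-closed α β no-countermodel with Completeness.decide (closure-closed Σ-closed α β) α β
... | Completeness.derivable d = ⋁-singleton (precompose (pair ⇒-refl (const ⇒-refl)) d)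
... | Completeness.countermodel m mm tα fβ = ⊥-elim (no-countermodel record
  { Σ⁺      = Σ ++ subformulas α ++ subformulas β
  ; closed  = closure-closed Σ-closed α β
  ; Σ⊆Σ⁺    = ∈-++⁺ˡ
  ; α∈      = ∈-++⁺ʳ Σ (∈-++⁺ˡ {ys = subformulas β} (here refl))
  ; β∈      = ∈-++⁺ʳ Σ (∈-++⁺ʳ (subformulas α) (here refl))
  ; model   = m
  ; moment  = mm
  ; α-true  = tα (here refl)
  ; β-false = fβ (here refl)
  })

module _ {Σ Σ' : List Fm} (Σ⊆Σ' : ∀ {φ} → φ ∈ Σ → φ ∈ Σ') where
  restrictType : ∀ {ℓ} → IsType Σ' ℓ → IsType Σ ℓ
  restrictType T = record
    { bot  = IsType.bot T ∘ Σ⊆Σ'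
    ; and⁺ = IsType.and⁺ T ∘ Σ⊆Σ'
    ; and⁻ = IsType.and⁻ T ∘ Σ⊆Σ'
    ; or⁺  = IsType.or⁺ T ∘ Σ⊆Σ'
    ; or⁻  = IsType.or⁻ T ∘ Σ⊆Σ'
    ; imp  = IsType.imp T ∘ Σ⊆Σ'
    ; dia  = IsType.dia T ∘ Σ⊆Σ'
    }

  restrictMoment : ∀ {t} → IsMoment Σ' t → IsMoment Σ t
  restrictMoment M = record
    { typed   = restrictType ∘ IsMoment.typed M
    ; mono    = λ h φ → IsMoment.mono M h φ ∘ Σ⊆Σ'
    ; witness = λ p → IsMoment.witness M p ∘ Σ⊆Σ'
    }

subMoment : ∀ {Σ} t y → IsMoment Σ t → IsMoment Σ (sub t y)
subMoment {Σ} t y M = record { typed = typed ; mono = mono ; witness = witness }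
  where
  typed : ∀ r → IsType Σ (lab (sub t y) r)
  typed r = subst (IsType Σ) (sym (fromSub-lab t y r)) (IsMoment.typed M (fromSub t y r))
  mono : ∀ {r r'} → r ≼ r' → ∀ φ → φ ∈ Σ → lab (sub t y) r φ ≡ true → lab (sub t y) r' φ ≡ true
  mono {r} {r'} h φ φ∈ rewrite fromSub-lab t y r | fromSub-lab t y r' = IsMoment.mono M (fromSub-mono t y h) φ φ∈
  witness : ∀ r {φ ψ} → φ ⇒ ψ ∈ Σ → lab (sub t y) r (φ ⇒ ψ) ≡ false →
            ∃ λ q → r ≼ q × lab (sub t y) q φ ≡ true × lab (sub t y) q ψ ≡ false
  witness r {φ} {ψ} ⇒∈ f rewrite fromSub-lab t y r with IsMoment.witness M (fromSub t y r) ⇒∈ f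
  ... | z , r≼z , tφ , fψ =
    q , fromSub-reflects t y (subst (fromSub t y r ≼_) (sym q↦z) r≼z) , transport tφ , transport fψ
    where
    y≼z : y ≼ z
    y≼z = ≼-trans (fromSub-above t y r) r≼z
    q : Pos (sub t y)
    q = toSub t y z y≼z
    q↦z : fromSub t y q ≡ z
    q↦z = fromSub-toSub t y z y≼z
    transport : ∀ {χ b} → lab t z χ ≡ b → lab (sub t y) q χ ≡ b
    transport {χ} e = trans (cong (λ ℓ → ℓ χ) (fromSub-lab t y q)) (trans (cong (λ x → lab t x χ) q↦z) e)

module Reduction (Σ : List Fm) where
  ⊴-refl : ∀ t → _⊴_ Σ t t
  ⊴-refl t = record
    { ι = id ; π = id ; ι-mono = id ; ι-refl = id ; ι-lab = λ _ _ _ → refl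
    ; π-mono = id ; π-ι = λ _ → refl ; π-lab = λ _ _ _ → refl }

  ⊴-trans : ∀ {s t u} → _⊴_ Σ s t → _⊴_ Σ t u → _⊴_ Σ s u
  ⊴-trans r r' = record
    { ι      = ι r' ∘ ι r
    ; π      = π r ∘ π r'
    ; ι-mono = ι-mono r' ∘ ι-mono r
    ; ι-refl = ι-refl r ∘ ι-refl r'
    ; ι-lab  = λ p φ φ∈ → trans (ι-lab r p φ φ∈) (ι-lab r' (ι r p) φ φ∈)
    ; π-mono = π-mono r ∘ π-mono r'
    ; π-ι    = λ p → trans (cong (π r) (π-ι r' (ι r p))) (π-ι r p)
    ; π-lab  = λ x φ φ∈ → trans (π-lab r' x φ φ∈) (π-lab r (π r' x) φ φ∈)
    }

  π-top : ∀ {s t} (r : _⊴_ Σ s t) → π r (top t) ≡ top s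
  π-top {s} {t} r = ≼top⇒≡top s (subst (π r (top t) ≼_) (π-ι r (top s)) (π-mono r (top-least t (ι r (top s)))))

  ⊴-rootLabel : ∀ {s t} (r : _⊴_ Σ s t) → _≈L_ Σ (rootLabel t) (rootLabel s)
  ⊴-rootLabel {s} {t} r φ φ∈ = trans (π-lab r (top t) φ φ∈) (cong (λ p → lab s p φ) (π-top r))

  ProperReduct : Tree → Set
  ProperReduct t = ∃ λ s → IsMoment Σ s × ∃ λ (r : _⊴_ Σ s t) → ∃ λ x → ∀ p → ι r p ≢ x

  reducible⇒proper-reduct : ∀ t → ¬ Irreducible Σ t → ¬ ¬ ProperReduct t
  reducible⇒proper-reduct t reducible no-proper = reducible hit
    where
    hit : ∀ s → IsMoment Σ s → (r : _⊴_ Σ s t) → ∀ x → ∃ λ p → ι r p ≡ x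
    hit s s-moment r x with Any.any? (λ p → ι r p ≟ᴾ x) (positions s)
    ... | yes found = let (p , _ , eq) = find found in p , eq
    ... | no missed = ⊥-elim (no-proper (s , s-moment , r , x , λ p eq → missed (lose (∈-positions s p) eq)))

  irreducible-reduct : ∀ t → IsMoment Σ t → ¬ ¬ ∃ λ s → InI Σ s × _⊴_ Σ s t
  irreducible-reduct t = go (suc (size t)) t ≤-refl
    where
    go : ∀ n t → size t ℕ.< n → IsMoment Σ t → ¬ ¬ ∃ λ s → InI Σ s × _⊴_ Σ s t
    go (suc n) t (s≤s size≤n) t-moment none =
      reducible⇒proper-reduct t (λ irreducible → none (t , (t-moment , irreducible) , ⊴-refl t))
        λ (s , s-moment , r , x , missed) →
          go n s (<-≤-trans (injective-missing⇒size< (ι r) (≼-reflecting⇒injective (ι-refl r)) x missed) size≤n)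
             s-moment λ (u , u-irreducible , r') → none (u , u-irreducible , ⊴-trans r' r)

∈-plus : ∀ {ℓ : Label} φs {φ} → φ ∈ φs → ℓ φ ≡ true → φ ∈ plus ℓ φs
∈-plus {ℓ} (ψ ∷ φs) φ∈ t with ℓ ψ in eq | φ∈
... | true  | here refl = here refl
... | false | here refl = clash t eq
... | true  | there φ∈' = there (∈-plus φs φ∈' t)
... | false | there φ∈' = ∈-plus φs φ∈' t

∈-minus : ∀ {ℓ : Label} φs {φ} → φ ∈ φs → ℓ φ ≡ false → φ ∈ minus ℓ φs
∈-minus {ℓ} (ψ ∷ φs) φ∈ f with ℓ ψ in eq | φ∈
... | false | here refl = here refl
... | true  | here refl = clash eq f
... | false | there φ∈' = there (∈-minus φs φ∈' f)
... | true  | there φ∈' = ∈-minus φs φ∈' f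

plus-sound : ∀ {ℓ : Label} φs {φ} → φ ∈ plus ℓ φs → φ ∈ φs × ℓ φ ≡ true
plus-sound {ℓ} (ψ ∷ φs) φ∈ with ℓ ψ in eq | φ∈
... | true  | here refl = here refl , eq
... | true  | there φ∈' = map₁ there (plus-sound φs φ∈')
... | false | φ∈'       = map₁ there (plus-sound φs φ∈')

minus-sound : ∀ {ℓ : Label} φs {φ} → φ ∈ minus ℓ φs → φ ∈ φs × ℓ φ ≡ false
minus-sound {ℓ} (ψ ∷ φs) φ∈ with ℓ ψ in eq | φ∈
... | false | here refl = here refl , eq
... | false | there φ∈' = map₁ there (minus-sound φs φ∈')
... | true  | φ∈'       = map₁ there (minus-sound φs φ∈')

-- What a type ℓ forces true, resp. false, at every S_T-successor: one constructor per clause of S_T.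
module _ (Σ : List Fm) (ℓ : Label) where
  data NextTrue : Fm → Set where
    ○-true    : ∀ {φ} → ○ φ ∈ Σ → ℓ (○ φ) ≡ true → NextTrue φ
    ◇-pending : ∀ {φ} → ◇ φ ∈ Σ → ℓ (◇ φ) ≡ true → ℓ φ ≡ false → NextTrue (◇ φ)

  data NextFalse : Fm → Set where
    ○-false : ∀ {φ} → ○ φ ∈ Σ → ℓ (○ φ) ≡ false → NextFalse φ
    ◇-false : ∀ {φ} → ◇ φ ∈ Σ → ℓ (◇ φ) ≡ false → NextFalse (◇ φ)

nextTrueAt : Label → Fm → List Fm
nextTrueAt ℓ (○ φ) = if ℓ (○ φ) then φ ∷ [] else []
nextTrueAt ℓ (◇ φ) = if ℓ (◇ φ) then (if ℓ φ then [] else ◇ φ ∷ []) else []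
nextTrueAt ℓ _     = []

nextFalseAt : Label → Fm → List Fm
nextFalseAt ℓ (○ φ) = if ℓ (○ φ) then [] else φ ∷ []
nextFalseAt ℓ (◇ φ) = if ℓ (◇ φ) then [] else ◇ φ ∷ []
nextFalseAt ℓ _     = []

nextTrue nextFalse : List Fm → Label → List Fm
nextTrue  Σ ℓ = concatMap (nextTrueAt ℓ) Σ
nextFalse Σ ℓ = concatMap (nextFalseAt ℓ) Σ

module _ {Σ : List Fm} {ℓ : Label} where
  ∈-nextTrue : ∀ {φ} → NextTrue Σ ℓ φ → φ ∈ nextTrue Σ ℓ
  ∈-nextTrue (○-true {φ} ○∈ t) = ∈-concatMap⁺ (nextTrueAt ℓ) (lose ○∈ required)
    where
    required : φ ∈ nextTrueAt ℓ (○ φ)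
    required rewrite t = here refl
  ∈-nextTrue (◇-pending {φ} ◇∈ t f) = ∈-concatMap⁺ (nextTrueAt ℓ) (lose ◇∈ required)
    where
    required : ◇ φ ∈ nextTrueAt ℓ (◇ φ)
    required rewrite t | f = here refl

  nextTrue-sound : ∀ {φ} → φ ∈ nextTrue Σ ℓ → NextTrue Σ ℓ φ
  nextTrue-sound φ∈ = let (χ , χ∈ , φ∈χ) = find (∈-concatMap⁻ (nextTrueAt ℓ) φ∈) in at χ χ∈ φ∈χ
    where
    at : ∀ χ {φ} → χ ∈ Σ → φ ∈ nextTrueAt ℓ χ → NextTrue Σ ℓ φ
    at (○ φ) χ∈ φ∈ with ℓ (○ φ) in t | φ∈
    ... | true | here refl = ○-true χ∈ t
    at (◇ φ) χ∈ φ∈ with ℓ (◇ φ) in t | ℓ φ in f | φ∈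
    ... | true | false | here refl = ◇-pending χ∈ t f
    at ⊥ᶠ      _ ()
    at (var _) _ ()
    at (_ ∧ _) _ ()
    at (_ ∨ _) _ ()
    at (_ ⇒ _) _ ()

  ∈-nextFalse : ∀ {φ} → NextFalse Σ ℓ φ → φ ∈ nextFalse Σ ℓ
  ∈-nextFalse (○-false {φ} ○∈ f) = ∈-concatMap⁺ (nextFalseAt ℓ) (lose ○∈ required)
    where
    required : φ ∈ nextFalseAt ℓ (○ φ)
    required rewrite f = here refl
  ∈-nextFalse (◇-false {φ} ◇∈ f) = ∈-concatMap⁺ (nextFalseAt ℓ) (lose ◇∈ required)
    where
    required : ◇ φ ∈ nextFalseAt ℓ (◇ φ)
    required rewrite f = here refl

  nextFalse-sound : ∀ {φ} → φ ∈ nextFalse Σ ℓ → NextFalse Σ ℓ φ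
  nextFalse-sound φ∈ = let (χ , χ∈ , φ∈χ) = find (∈-concatMap⁻ (nextFalseAt ℓ) φ∈) in at χ χ∈ φ∈χ
    where
    at : ∀ χ {φ} → χ ∈ Σ → φ ∈ nextFalseAt ℓ χ → NextFalse Σ ℓ φ
    at (○ φ) χ∈ φ∈ with ℓ (○ φ) in f | φ∈
    ... | false | here refl = ○-false χ∈ f
    at (◇ φ) χ∈ φ∈ with ℓ (◇ φ) in f | φ∈
    ... | false | here refl = ◇-false χ∈ f
    at ⊥ᶠ      _ ()
    at (var _) _ ()
    at (_ ∧ _) _ ()
    at (_ ∨ _) _ ()
    at (_ ⇒ _) _ ()

module _ (Σ : List Fm) where
  record Copy (u t : Tree) : Set where
    field
      copy      : Pos u → Pos t
      copy-mono : ∀ {p q} → p ≼ q → copy p ≼ copy q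
      copy-lab  : ∀ p → _≈L_ Σ (lab u p) (lab t (copy p))

  open Copy public

module _ {Σ : List Fm} where
  infixr 9 _∘ᶜ_
  _∘ᶜ_ : ∀ {s t u} → Copy Σ t u → Copy Σ s t → Copy Σ s u
  c ∘ᶜ c' = record
    { copy      = copy c ∘ copy c'
    ; copy-mono = copy-mono c ∘ copy-mono c'
    ; copy-lab  = λ p φ φ∈ → trans (copy-lab c' p φ φ∈) (copy-lab c (copy c' p) φ φ∈)
    }

  Iso⇒Copy : ∀ {s t} → Iso Σ s t → Copy Σ s t
  Iso⇒Copy i = record { copy = Iso.f i ; copy-mono = Iso.f-mono i ; copy-lab = Iso.f-lab i }

  Iso⇒Copy⁻¹ : ∀ {s t} → Iso Σ s t → Copy Σ t s
  Iso⇒Copy⁻¹ {s} {t} i = record { copy = Iso.g i ; copy-mono = Iso.g-mono i ; copy-lab = g-lab }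
    where
    g-lab : ∀ q → _≈L_ Σ (lab t q) (lab s (Iso.g i q))
    g-lab q φ φ∈ = trans (cong (λ p → lab t p φ) (sym (Iso.fg i q))) (sym (Iso.f-lab i (Iso.g i q) φ φ∈))

  ⊴⇒Copy : ∀ {s t} → _⊴_ Σ s t → Copy Σ s t
  ⊴⇒Copy r = record { copy = ι r ; copy-mono = ι-mono r ; copy-lab = ι-lab r }

  sub⇒Copy : ∀ t y → Copy Σ (sub t y) t
  sub⇒Copy t y = record
    { copy      = fromSub t y
    ; copy-mono = fromSub-mono t y
    ; copy-lab  = λ r φ _ → cong (λ ℓ → ℓ φ) (fromSub-lab t y r)
    }

module Simulation (Σ : List Fm) (cl : SubClosed Σ) where
  module S = Characteristic (λ ℓ → plus ℓ Σ) (λ ℓ → minus ℓ Σ)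
  module N = Characteristic (nextTrue Σ) (nextFalse Σ)

  Next : Tree → Fm
  Next = N.char

  mutual
    Sim≡char : ∀ t → Sim Σ t ≡ S.char t
    Sim≡char (node ℓ cs) = cong (λ ds → ⋀ (plus ℓ Σ) ⇒ ⋁ (minus ℓ Σ) ∨ ⋁ ds) (descSims≡charDesc cs)

    descSims≡charDesc : ∀ cs → descSims Σ cs ≡ S.charDesc cs
    descSims≡charDesc []       = refl
    descSims≡charDesc (c ∷ cs) = cong₂ _∷_ (Sim≡char c) (cong₂ _++_ (descOf≡charBelow c) (descSims≡charDesc cs))

    descOf≡charBelow : ∀ c → descOf Σ c ≡ S.charBelow c
    descOf≡charBelow (node ℓ ds) = descSims≡charDesc ds

  nextTrue-forced : ∀ ℓ {φ} → φ ∈ nextTrue Σ ℓ → ⋀ (plus ℓ Σ) ▷ ⋁ (minus ℓ Σ) ∨ ○ φ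
  nextTrue-forced ℓ φ∈ with nextTrue-sound φ∈
  ... | ○-true ○∈ t       = inr (⋀-elim (∈-plus Σ ○∈ t))
  ... | ◇-pending ◇∈ t f =
    case (by ◇-unfold (⋀-elim (∈-plus Σ ◇∈ t))) (inl (by (⋁-intro (∈-minus Σ (cl ◇ˢ ◇∈) f)) hyp)) (inr hyp)

  nextFalse-refuted : ∀ ℓ {φ} → φ ∈ nextFalse Σ ℓ → ∃ λ ψ → ψ ∈ minus ℓ Σ × ⊢ ○ φ ⇒ ψ
  nextFalse-refuted ℓ φ∈ with nextFalse-sound φ∈
  ... | ○-false ○∈ f = _ , ∈-minus Σ ○∈ f , ⇒-refl
  ... | ◇-false ◇∈ f = _ , ∈-minus Σ ◇∈ f , ○◇⇒◇

  mutual
    ⊢○Next⇒Sim : ∀ t → ⊢ ○ Next t ⇒ S.char t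
    ⊢○Next⇒Sim (node ℓ cs) =
      abs (case (precompose ax-∧E₂ (○⋀-collect (nextTrue Σ ℓ) (nextTrue-forced ℓ))) (inl hyp) successors)
      where
      successors : (○ Next (node ℓ cs) ∧ ⋀ (plus ℓ Σ)) ∧ ○ ⋀ (nextTrue Σ ℓ) ▷ ⋁ (minus ℓ Σ) ∨ ⋁ (S.charDesc cs)
      successors =
        case (by ax-○∨ (by ax-○⇒ (by ax-∧E₁ (weaken ⇒-refl)) · hyp))
          (inl (by (○⋁-mono (nextFalse Σ ℓ) (minus ℓ Σ) (nextFalse-refuted ℓ)) hyp))
          (inr (by (○⋁-mono (N.charDesc cs) (S.charDesc cs) (⊢○Next⇒Sim-desc cs)) hyp))

    ⊢○Next⇒Sim-desc : ∀ cs {φ} → φ ∈ N.charDesc cs → ∃ λ ψ → ψ ∈ S.charDesc cs × ⊢ ○ φ ⇒ ψ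
    ⊢○Next⇒Sim-desc (c ∷ cs) (here refl) = S.char c , here refl , ⊢○Next⇒Sim c
    ⊢○Next⇒Sim-desc (node ℓ ds ∷ cs) (there φ∈) with ∈-++⁻ (N.charDesc ds) φ∈
    ... | inj₁ φ∈ds = let (ψ , ψ∈ , d) = ⊢○Next⇒Sim-desc ds φ∈ds in ψ , there (∈-++⁺ˡ ψ∈) , d
    ... | inj₂ φ∈cs = let (ψ , ψ∈ , d) = ⊢○Next⇒Sim-desc cs φ∈cs in ψ , there (∈-++⁺ʳ (S.charDesc ds) ψ∈) , d

  module InCountermodel {α β : Fm} (cm : Countermodel Σ α β) where
    open Countermodel cm public
    open Truth closed moment using (false-downward; ⋀-true⇒)

    meets⇒≈ : ∀ {ℓ x} → S.MeetsAt closed moment ℓ x → _≈L_ Σ ℓ (lab model x)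
    meets⇒≈ {ℓ} (t , f) φ φ∈ with ℓ φ in eq
    ... | true  = sym (t (∈-plus Σ φ∈ eq))
    ... | false = sym (f (∈-minus Σ φ∈ eq))

    ≈⇒meets : ∀ {ℓ x} → _≈L_ Σ ℓ (lab model x) → S.MeetsAt closed moment ℓ x
    ≈⇒meets ℓ≈ = (λ φ∈ → let (φ∈Σ , t) = plus-sound Σ φ∈ in trans (sym (ℓ≈ _ φ∈Σ)) t)
                , (λ φ∈ → let (φ∈Σ , f) = minus-sound Σ φ∈ in trans (sym (ℓ≈ _ φ∈Σ)) f)

    Sim-refuted⇒Copy : ∀ t → Sim Σ t ∈ Σ⁺ → rootLabel model (Sim Σ t) ≡ false → Copy Σ t model
    Sim-refuted⇒Copy t ∈Σ⁺ f = record { copy = emb ; copy-mono = mono ; copy-lab = meets⇒≈ ∘ meets }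
      where
      E : S.Embedding closed moment t (top model)
      E = S.refuted⇒embeds closed moment t (subst (_∈ Σ⁺) (Sim≡char t) ∈Σ⁺)
                                             (subst (λ φ → rootLabel model φ ≡ false) (Sim≡char t) f)
      open S.Embedding E

    Copy⇒Sim-refuted : ∀ {u} → Copy Σ u model → Sim Σ u ∈ Σ⁺ → rootLabel model (Sim Σ u) ≡ false
    Copy⇒Sim-refuted {u} c ∈Σ⁺ = false-downward (top-least model _) ∈Σ⁺
      (subst (λ φ → lab model (copy c (top u)) φ ≡ false) (sym (Sim≡char u))
        (S.embeds⇒refuted closed moment u (subst (_∈ Σ⁺) (Sim≡char u) ∈Σ⁺) E))
      where
      E : S.Embedding closed moment u (top model)
      E = record { emb = copy c ; above = top-least model _ ; mono = copy-mono c ; meets = ≈⇒meets ∘ copy-lab c }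

    ⋀Sim-true⇒no-Copy : ∀ L {u} → ⋀ (map (Sim Σ) L) ∈ Σ⁺ → rootLabel model (⋀ (map (Sim Σ) L)) ≡ true →
                        u ∈ L → ¬ Copy Σ u model
    ⋀Sim-true⇒no-Copy L ∈Σ⁺ t u∈L c =
      clash (⋀-true⇒ (map (Sim Σ) L) ∈Σ⁺ t Sim∈) (Copy⇒Sim-refuted c (⋀∈⇒∈ closed (map (Sim Σ) L) ∈Σ⁺ Sim∈))
      where
      Sim∈ = ∈-map⁺ (Sim Σ) u∈L

    meetsNext⇒ST : ∀ {ℓ x ℓ'} → N.MeetsAt closed moment ℓ x → _≈L_ Σ (lab model x) ℓ' → ST Σ ℓ ℓ'
    meetsNext⇒ST {ℓ} {x} {ℓ'} (t , f) x≈ = record { next = next ; dia⁺ = dia⁺ ; dia⁻ = dia⁻ }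
      where
      next : ∀ {φ} → ○ φ ∈ Σ → ℓ (○ φ) ≡ ℓ' φ
      next {φ} ○∈ with ℓ (○ φ) in eq
      ... | true  = sym (trans (sym (x≈ φ (cl ○ˢ ○∈))) (t (∈-nextTrue (○-true ○∈ eq))))
      ... | false = sym (trans (sym (x≈ φ (cl ○ˢ ○∈))) (f (∈-nextFalse (○-false ○∈ eq))))
      dia⁺ : ∀ {φ} → ◇ φ ∈ Σ → ℓ (◇ φ) ≡ true → ℓ φ ≡ false → ℓ' (◇ φ) ≡ true
      dia⁺ ◇∈ t◇ fφ = trans (sym (x≈ _ ◇∈)) (t (∈-nextTrue (◇-pending ◇∈ t◇ fφ)))
      dia⁻ : ∀ {φ} → ◇ φ ∈ Σ → ℓ (◇ φ) ≡ false → ℓ' (◇ φ) ≡ false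
      dia⁻ ◇∈ f◇ = trans (sym (x≈ _ ◇∈)) (f (∈-nextFalse (◇-false ◇∈ f◇)))

    embedding⇒SI : ∀ {w y} (E : N.Embedding closed moment w y) {v} →
                   _⊴_ Σ v (sub model (N.Embedding.emb E (top w))) → SI Σ w v
    embedding⇒SI {w} E {v} r = record { R = R ; roots = roots ; sensible = sensible ; confluent = confluent }
      where
      open N.Embedding E
      y₀ : Pos model
      y₀ = emb (top w)
      y₀≼ : ∀ p → y₀ ≼ emb p
      y₀≼ p = mono (top-least w p)
      e : Pos w → Pos (sub model y₀)
      e p = toSub model y₀ (emb p) (y₀≼ p)
      e↦ : ∀ p → fromSub model y₀ (e p) ≡ emb p
      e↦ p = fromSub-toSub model y₀ (emb p) (y₀≼ p)
      image : Pos w → Pos v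
      image = π r ∘ e
      R : Pos w → Pos v → Set
      R x z = image x ≡ z
      image-lab : ∀ x → _≈L_ Σ (lab model (emb x)) (lab v (image x))
      image-lab x φ φ∈ = begin
        lab model (emb x) φ                   ≡⟨ cong (λ p → lab model p φ) (e↦ x) ⟨
        lab model (fromSub model y₀ (e x)) φ  ≡⟨ cong (λ ℓ → ℓ φ) (fromSub-lab model y₀ (e x)) ⟨
        lab (sub model y₀) (e x) φ            ≡⟨ π-lab r (e x) φ φ∈ ⟩
        lab v (image x) φ                     ∎
        where open ≡-Reasoning
      roots : image (top w) ≡ top v
      roots = trans (cong (π r) (≼-reflecting⇒injective (fromSub-reflects model y₀)
                                   (trans (e↦ (top w)) (sym (fromSub-top model y₀)))))
                    (Reduction.π-top Σ r)
      sensible : ∀ {x z} → R x z → ST Σ (lab w x) (lab v z)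
      sensible {x} refl = meetsNext⇒ST (meets x) (image-lab x)
      confluent : ∀ {x z x'} → R x z → x ≼ x' → ∃ λ z' → z ≼ z' × R x' z'
      confluent {x} {_} {x'} refl x≼x' =
        image x' , π-mono r (fromSub-reflects model y₀ (subst₂ _≼_ (sym (e↦ x)) (sym (e↦ x')) (mono x≼x'))) , refl

  ψ∈ℓ⁻⇒⊢ψ⇒Sim : ∀ {ψ} → ψ ∈ Σ → ∀ w → rootLabel w ψ ≡ false → ⊢ ψ ⇒ Sim Σ w
  ψ∈ℓ⁻⇒⊢ψ⇒Sim ψ∈ (node ℓ cs) f = abs (inl (by (⋁-intro (∈-minus Σ ψ∈ f)) (weaken ⇒-refl)))

  ψ∈ℓ⁺⇒⊢[ψ⇒Sim]⇒Sim : ∀ {ψ} → ψ ∈ Σ → ∀ w → rootLabel w ψ ≡ true → ⊢ (ψ ⇒ Sim Σ w) ⇒ Sim Σ w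
  ψ∈ℓ⁺⇒⊢[ψ⇒Sim]⇒Sim ψ∈ (node ℓ cs) t = abs (weaken ⇒-refl · by (⋀-elim (∈-plus Σ ψ∈ t)) hyp · hyp)

  ≼I⇒⊢Sim⇒Sim : ∀ w v → _≼I_ Σ w v → ⊢ Sim Σ v ⇒ Sim Σ w
  ≼I⇒⊢Sim⇒Sim w v (x , v≅w[x]) = completeness cl (Sim Σ v) (Sim Σ w) λ cm →
    let open InCountermodel cm in
    clash α-true (Copy⇒Sim-refuted (Sim-refuted⇒Copy w β∈ β-false ∘ᶜ sub⇒Copy w x ∘ᶜ Iso⇒Copy v≅w[x]) α∈)

  ⊢⋀Sim⇒ψ : ∀ {ψ} → ψ ∈ Σ → ∀ L → (∀ u → InI Σ u → rootLabel u ψ ≡ false → ∃ λ u' → u' ∈ L × Iso Σ u u') →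
            ⊢ ⋀ (map (Sim Σ) L) ⇒ ψ
  ⊢⋀Sim⇒ψ {ψ} ψ∈ L enumerates = completeness cl _ ψ λ cm →
    let open InCountermodel cm in
    Reduction.irreducible-reduct Σ model (restrictMoment Σ⊆Σ⁺ moment) λ (v , v-irreducible , r) →
      let (u , u∈L , v≅u) = enumerates v v-irreducible (trans (sym (Reduction.⊴-rootLabel Σ r ψ ψ∈)) β-false)
      in ⋀Sim-true⇒no-Copy L α∈ α-true u∈L (⊴⇒Copy r ∘ᶜ Iso⇒Copy⁻¹ v≅u)

  ⊢⋀Sim⇒Next : ∀ w L → (∀ v → InI Σ v → SI Σ w v → ∃ λ v' → v' ∈ L × Iso Σ v v') →
               ⊢ ⋀ (map (Sim Σ) L) ⇒ Next w
  ⊢⋀Sim⇒Next w L enumerates = completeness cl _ (Next w) λ cm →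
    let open InCountermodel cm
        E = N.refuted⇒embeds closed moment w β∈ β-false
        y₀ = N.Embedding.emb E (top w)
    in Reduction.irreducible-reduct Σ (sub model y₀) (subMoment model y₀ (restrictMoment Σ⊆Σ⁺ moment))
         λ (v , v-irreducible , r) →
           let (v' , v'∈L , v≅v') = enumerates v v-irreducible (embedding⇒SI E r)
           in ⋀Sim-true⇒no-Copy L α∈ α-true v'∈L (sub⇒Copy model y₀ ∘ᶜ ⊴⇒Copy r ∘ᶜ Iso⇒Copy⁻¹ v≅v')

  ⊢○⋀Sim⇒Sim : ∀ w L → (∀ v → InI Σ v → SI Σ w v → ∃ λ v' → v' ∈ L × Iso Σ v v') →
               ⊢ ○ ⋀ (map (Sim Σ) L) ⇒ Sim Σ w
  ⊢○⋀Sim⇒Sim w L enumerates = subst (λ φ → ⊢ ○ ⋀ (map (Sim Σ) L) ⇒ φ) (sym (Sim≡char w))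
    (by (⊢○Next⇒Sim w) (○-mono (⊢⋀Sim⇒Next w L enumerates)))

proposition5p4 : (Σ₀ : List Fm) → SubClosed Σ₀ →
  (w : Tree) → InI Σ₀ w → (ψ : Fm) → ψ ∈ Σ₀ →
    -- (1)
    (lab w (top w) ψ ≡ false → ⊢ ψ ⇒ Sim Σ₀ w)
    -- (2)
  × (lab w (top w) ψ ≡ true → ⊢ (ψ ⇒ Sim Σ₀ w) ⇒ Sim Σ₀ w)
    -- (3)
  × ((v : Tree) → InI Σ₀ v → _≼I_ Σ₀ w v → ⊢ Sim Σ₀ v ⇒ Sim Σ₀ w)
    -- (4)  L enumerates {u ∈ I | ψ ∈ ℓ⁻(u)} up to isomorphism
  × ((L : List Tree) →
       (∀ {u} → u ∈ L → InI Σ₀ u × lab u (top u) ψ ≡ false) →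
       ((u : Tree) → InI Σ₀ u → lab u (top u) ψ ≡ false →
          ∃ λ u' → u' ∈ L × Iso Σ₀ u u') →
       ⊢ ⋀ (map (Sim Σ₀) L) ⇒ ψ)
    -- (5)  L enumerates {v ∈ I | w S_I v} up to isomorphism
  × ((L : List Tree) →
       (∀ {v} → v ∈ L → InI Σ₀ v × SI Σ₀ w v) →
       ((v : Tree) → InI Σ₀ v → SI Σ₀ w v →
          ∃ λ v' → v' ∈ L × Iso Σ₀ v v') →
       ⊢ ○ ⋀ (map (Sim Σ₀) L) ⇒ Sim Σ₀ w)
proposition5p4 Σ₀ cl w _ ψ ψ∈ =
    ψ∈ℓ⁻⇒⊢ψ⇒Sim ψ∈ w
  , ψ∈ℓ⁺⇒⊢[ψ⇒Sim]⇒Sim ψ∈ w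
  , (λ v _ → ≼I⇒⊢Sim⇒Sim w v)
  , (λ L _ → ⊢⋀Sim⇒ψ ψ∈ L)
  , (λ L _ → ⊢○⋀Sim⇒Sim w L)
  where open Simulation Σ₀ cl
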